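{- Let $(N,\mathcal{W})$ be a simple game with $n=|N|$ players. If $\nu(N,\mathcal{W})=n$, then $n\ge2$ and, up to relabeling of players, $(N,\mathcal{W})=[n-1;1,\dots,1]$. If $\nu(N,\mathcal{W})=n-1$, then up to relabeling of players $(N,\mathcal{W})$ is one of the following: (1) $[2n-4;2^{n-2},1^2]$, with $t=2$ equivalence classes, for some $n\ge3$; (2) $[1;1^3]$, with $t=1$, for $n=3$; (3) $[2n-5;2^{n-3},1^3]$, with $t=2$, for some $n\ge4$; (4) $[n-2;1^{n-1},0]$, with $t=2$, for some $n\ge3$; (5) $[5n-2k-9;5^{n-k-1},3^k,1^1]$, with $t=3$, for some $n\ge4$ and $2\le k\le n-2$.
   Context: A simple game $(N,\mathcal{W})$: $N$ finite, $\mathcal{W}$ a family of subsets (winning coalitions) with $\emptyset\notin\mathcal{W}$, $N\in\mathcal{W}$, closed under supersets; $\nu(N,\mathcal{W})$ is the minimum number of winning coalitions with empty intersection ($\infty$ if none). $[q;w_1,\dots,w_n]$ denotes the weighted game in which $S$ is winning iff $\sum_{i\in S}w_i\ge q$; $a^k$ denotes $k$ players of weight $a$. Equivalence classes: write $i\sqsupseteq j$ if for every $S$ with $j\in S\subseteq N\setminus\{i\}$, $S\in\mathcal{W}$ implies $(S\setminus\{j\})\cup\{i\}\in\mathcal{W}$; $i,j$ are equivalent if $i\sqsupseteq j$ and $j\sqsupseteq i$; $t$ is the number of equivalence classes. -}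

module Defs where

open import Data.Nat using (ℕ; zero; suc; _+_; _≤ᵇ_; _<ᵇ_; _≤_; _∸_)
open import Data.Bool using (Bool; true; false; if_then_else_)
open import Data.Fin using (Fin; toℕ) renaming (zero to fzero; suc to fsuc)
open import Data.Fin.Subset using (Subset; ⊥; ⊤)
open import Data.Fin.Permutation using (Permutation′; _⟨$⟩ʳ_)
open import Data.Vec using (Vec; []; _∷_; lookup; tabulate; _[_]≔_)
open import Data.List using (List; length)
open import Data.List.Relation.Unary.All using (All)
open import Data.List.Relation.Unary.Any using (Any)
open import Data.Product using (Σ; ∃; _×_)
open import Function using (_∘_)
open import Function.Bundles using (_⇔_)
open import Relation.Binary.PropositionalEquality using (_≡_)

record SimpleGame (n : ℕ) : Set where
  field
    win       : Subset n → Bool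
    empty-los : win ⊥ ≡ false
    full-win  : win ⊤ ≡ true
    monotone  : ∀ (S T : Subset n) → (∀ i → lookup S i ≡ true → lookup T i ≡ true) →
                win S ≡ true → win T ≡ true
open SimpleGame public

EmptyIntersection : ∀ {n} → List (Subset n) → Set
EmptyIntersection {n} L = ∀ (i : Fin n) → Any (λ S → lookup S i ≡ false) L

WinningEmptyFamily : ∀ {n} → SimpleGame n → List (Subset n) → Set
WinningEmptyFamily G L = All (λ S → win G S ≡ true) L × EmptyIntersection L

-- ν(N,W) = m : there are m winning coalitions with empty intersection, and
-- every family of winning coalitions with empty intersection has at least m members.
NuEq : ∀ {n} → SimpleGame n → ℕ → Set
NuEq {n} G m =
  (∃ λ (L : List (Subset n)) → length L ≡ m × WinningEmptyFamily G L) ×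
  (∀ (L : List (Subset n)) → WinningEmptyFamily G L → m ≤ length L)

weightOf : ∀ {n} → Subset n → (Fin n → ℕ) → ℕ
weightOf []          w = 0
weightOf (b ∷ S) w = (if b then w fzero else 0) + weightOf S (w ∘ fsuc)

weighted : ∀ {n} → ℕ → (Fin n → ℕ) → Subset n → Bool
weighted q w S = q ≤ᵇ weightOf S w

-- G equals the game with winning-function f up to relabeling of players:
-- player i of f corresponds to player π(i) of G.
IsoTo : ∀ {n} → SimpleGame n → (Subset n → Bool) → Set
IsoTo {n} G f = ∃ λ (π : Permutation′ n) →
  ∀ (S : Subset n) → win G S ≡ f (tabulate (λ i → lookup S (π ⟨$⟩ʳ i)))

Desir : ∀ {n} → SimpleGame n → Fin n → Fin n → Set
Desir {n} G i j = ∀ (S : Subset n) → lookup S j ≡ true → lookup S i ≡ false →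
  win G S ≡ true → win G ((S [ j ]≔ false) [ i ]≔ true) ≡ true

Equivalent : ∀ {n} → SimpleGame n → Fin n → Fin n → Set
Equivalent G i j = Desir G i j × Desir G j i

NumClasses : ∀ {n} → SimpleGame n → ℕ → Set
NumClasses {n} G t = ∃ λ (c : Fin n → Fin t) →
  (∀ k → ∃ λ i → c i ≡ k) × (∀ i j → (c i ≡ c j) ⇔ Equivalent G i j)

w1 : (n : ℕ) → Fin n → ℕ
w1 n i = if toℕ i <ᵇ n ∸ 2 then 2 else 1
w3 : (n : ℕ) → Fin n → ℕ
w3 n i = if toℕ i <ᵇ n ∸ 3 then 2 else 1
w4 : (n : ℕ) → Fin n → ℕ
w4 n i = if toℕ i <ᵇ n ∸ 1 then 1 else 0
w5 : (n k : ℕ) → Fin n → ℕ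
w5 n k i = if toℕ i <ᵇ n ∸ k ∸ 1 then 5 else (if toℕ i <ᵇ n ∸ 1 then 3 else 1)

-- Call {x, y} an edge when N ∖ {x, y} wins. If ν ≥ n - 1, every N ∖ {x} wins (a family with empty
-- intersection has a member missing x), and no coalition missing three players wins: together with the
-- n - 3 coalitions N ∖ {u} for the other players u it would form a family of n - 2. The same count shows
-- that no two edges are disjoint, and that for ν = n there are no edges at all. So the game is decided by
-- its edges, which form a star or a triangle. In each case explicit weights w and a threshold d make a
-- coalition win iff the weight outside it is at most d; the number of players of each weight then gives
-- the relabelling and the equivalence classes.

module Submission where

open import Defs
open import Data.Bool using (Bool; true; false; if_then_else_; not; _∧_; _∨_; T)
import Data.Bool.Properties as Bool
open import Data.Bool.Properties using (if-float; ¬-not)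
open import Data.Empty using (⊥; ⊥-elim)
open import Data.Fin using (Fin; toℕ; punchIn; punchOut) renaming (zero to fzero; suc to fsuc)
open import Data.Fin.Patterns using (0F; 1F; 2F)
open import Data.Fin.Permutation using (Permutation′; _⟨$⟩ʳ_; _⟨$⟩ˡ_; insert; insert-punchIn; inverseˡ; flip)
import Data.Fin.Permutation as Perm
open import Data.Fin.Properties using (_≟_; punchInᵢ≢i; punchIn-punchOut; suc-injective; pigeonhole; any?)
  renaming (<⇒≢ to <⇒≢ᶠ)
open import Data.Fin.Subset using (Subset) renaming (⊤ to full; ⊥ to ∅)
open import Data.List using (List; length; []; _∷_) renaming (tabulate to tabulateˡ; lookup to lookupˡ)
open import Data.List.Properties using (length-tabulate)
open import Data.List.Relation.Unary.All using (lookupAny; []; _∷_)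
import Data.List.Relation.Unary.All.Properties as All
open import Data.List.Relation.Unary.Any using (here)
import Data.List.Relation.Unary.Any as Any
import Data.List.Relation.Unary.Any.Properties as Any
open import Data.Nat using (ℕ; zero; suc; _+_; _*_; _∸_; _≤_; _<_; z≤n; s≤s; _≤ᵇ_; _<ᵇ_; _≤?_)
import Data.Nat as ℕ
open import Data.Nat.Properties hiding (_≟_; suc-injective)
open import Data.Nat.Tactic.RingSolver using (solve-∀)
open import Algebra.Properties.Semiring.Sum +-*-semiring
  using (sum; sum-cong-≗; ∑-distrib-+; ∑-comm; sum-remove; sum-permute; *-distribˡ-sum)
open import Data.Product using (Σ; ∃; ∃₂; _×_; _,_; proj₁; proj₂)
open import Data.Sum using (_⊎_; inj₁; inj₂)
open import Data.Unit using (tt)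
open import Data.Vec using ([]; _∷_; lookup; tabulate; _[_]≔_)
open import Data.Vec.Functional using (updateAt)
open import Data.Vec.Functional.Properties using (updateAt-updates; updateAt-minimal)
open import Data.Vec.Properties using (lookup-replicate; lookup∘update; lookup∘update′; lookup∘tabulate; []≔-commutes)
open import Function using (_∘_; const)
open import Function.Bundles using (mk⇔)
open import Relation.Binary using (tri<; tri≈; tri>)
open import Relation.Binary.PropositionalEquality hiding ([_])
open import Relation.Nullary using (Dec; yes; no; does; ¬_; ¬?; _×-dec_; contradiction)
open import Relation.Nullary.Decidable using (dec-true; dec-false; does-⇔)

[_] : Bool → ℕ
[ b ] = if b then 1 else 0

#_ : ∀ {n} → (Fin n → Bool) → ℕ
# P = sum (λ i → [ P i ])

_==_ : ∀ {n} → Fin n → Fin n → Bool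
x == y = does (x ≟ y)

==-refl : ∀ {n} (x : Fin n) → (x == x) ≡ true
==-refl x = dec-true (x ≟ x) refl

==-≢ : ∀ {n} {x y : Fin n} → x ≢ y → (x == y) ≡ false
==-≢ {x = x} {y} = dec-false (x ≟ y)

==⇒≡ : ∀ {n} {x y : Fin n} → (x == y) ≡ true → x ≡ y
==⇒≡ {x = x} {y} e with x ≟ y
... | yes x≡y = x≡y

==-false⇒≢ : ∀ {n} {x y : Fin n} → (x == y) ≡ false → x ≢ y
==-false⇒≢ {x = x} x==y refl = contradiction (trans (sym x==y) (==-refl x)) λ ()

==-comm : ∀ {n} (x y : Fin n) → (x == y) ≡ (y == x)
==-comm x y = does-⇔ (mk⇔ sym sym) (x ≟ y) (y ≟ x)

sum-const : ∀ n c → sum {n} (λ _ → c) ≡ n * c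
sum-const zero    c = refl
sum-const (suc n) c = cong (c +_) (sum-const n c)

#-cong : ∀ {n} {P Q : Fin n → Bool} → (∀ i → P i ≡ Q i) → # P ≡ # Q
#-cong P≗Q = sum-cong-≗ (cong [_] ∘ P≗Q)

[b]≤1 : ∀ b → [ b ] ≤ 1
[b]≤1 true  = s≤s z≤n
[b]≤1 false = z≤n

#≤n : ∀ {n} (P : Fin n → Bool) → # P ≤ n
#≤n {zero}  P = z≤n
#≤n {suc n} P = +-mono-≤ ([b]≤1 (P fzero)) (#≤n (P ∘ fsuc))

#-+-#-not : ∀ {n} (P : Fin n → Bool) → # P + # (not ∘ P) ≡ n
#-+-#-not {n} P = begin
  # P + # (not ∘ P)                   ≡⟨ ∑-distrib-+ (λ i → [ P i ]) (λ i → [ not (P i) ]) ⟨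
  sum (λ i → [ P i ] + [ not (P i) ]) ≡⟨ sum-cong-≗ (λ i → [b]+[not-b] (P i)) ⟩
  sum {n} (λ _ → 1)                   ≡⟨ sum-const n 1 ⟩
  n * 1                               ≡⟨ *-identityʳ n ⟩
  n                                   ∎
  where
  open ≡-Reasoning
  [b]+[not-b] : ∀ b → [ b ] + [ not b ] ≡ 1
  [b]+[not-b] true  = refl
  [b]+[not-b] false = refl

#-remove : ∀ {n} (P : Fin (suc n) → Bool) (i : Fin (suc n)) → # P ≡ [ P i ] + # (P ∘ punchIn i)
#-remove P i = sum-remove {i = i} (λ j → [ P j ])

∃⇒1≤# : ∀ {n} (P : Fin n → Bool) {i} → P i ≡ true → 1 ≤ # P
∃⇒1≤# {suc n} P {i} Pi rewrite #-remove P i | Pi = s≤s z≤n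

1≤#⇒∃ : ∀ {n} (P : Fin n → Bool) → 1 ≤ # P → ∃ λ i → P i ≡ true
1≤#⇒∃ {suc n} P 1≤#P with P fzero in P0
... | true  = fzero , P0
... | false = let i , Pi = 1≤#⇒∃ (P ∘ fsuc) 1≤#P in fsuc i , Pi

2≤#⇒∃-other : ∀ {n} (P : Fin n → Bool) (i : Fin n) → 2 ≤ # P → ∃ λ z → P z ≡ true × z ≢ i
2≤#⇒∃-other {suc n} P i 2≤#P =
  let t , Pt = 1≤#⇒∃ (P ∘ punchIn i) 1≤rest in punchIn i t , Pt , punchInᵢ≢i i t
  where
  1≤rest : 1 ≤ # (P ∘ punchIn i)
  1≤rest = +-cancelˡ-≤ 1 1 _ (≤-trans 2≤#P (≤-trans (≤-reflexive (#-remove P i))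
             (+-monoˡ-≤ _ ([b]≤1 (P i)))))

2≤# : ∀ {n} (P : Fin n → Bool) {x y} → x ≢ y → P x ≡ true → P y ≡ true → 2 ≤ # P
2≤# {suc n} P {x} {y} x≢y Px Py rewrite #-remove P x | Px =
  s≤s (∃⇒1≤# (P ∘ punchIn x) (trans (cong P (punchIn-punchOut x≢y)) Py))

#-singleton : ∀ {n} (x : Fin n) → # (_== x) ≡ 1
#-singleton {suc n} x = begin
  # (_== x)                          ≡⟨ #-remove (_== x) x ⟩
  [ x == x ] + # ((_== x) ∘ punchIn x) ≡⟨ cong₂ _+_ (cong [_] (==-refl x)) (#-cong (==-≢ ∘ punchInᵢ≢i x)) ⟩
  1 + sum {n} (λ _ → 0)             ≡⟨ cong suc (trans (sum-const n 0) (*-zeroʳ n)) ⟩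
  1                                  ∎
  where open ≡-Reasoning

third-player : ∀ {n} → 3 ≤ n → (x y : Fin n) → ∃ λ z → z ≢ x × z ≢ y
third-player {n} 3≤n x y =
  let z , z∉x , z≢y = 2≤#⇒∃-other (not ∘ (_== x)) y 2≤#others
  in z , ==-false⇒≢ (Bool.not-injective z∉x) , z≢y
  where
  2≤#others : 2 ≤ # (not ∘ (_== x))
  2≤#others = +-cancelˡ-≤ 1 2 _ (subst (3 ≤_) (sym split) 3≤n)
    where
    split : 1 + # (not ∘ (_== x)) ≡ n
    split = trans (cong (_+ # (not ∘ (_== x))) (sym (#-singleton x))) (#-+-#-not (_== x))

#≡n⇒all : ∀ {n} (P : Fin n → Bool) → # P ≡ n → ∀ x → P x ≡ true
#≡n⇒all {n} P #P≡n x with P x in Px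
... | true  = refl
... | false = ⊥-elim (1+n≰n (subst (1 ≤_) none (∃⇒1≤# (not ∘ P) {x} (cong not Px))))
  where
  none : # (not ∘ P) ≡ 0
  none = +-cancelˡ-≡ n _ 0 (trans (cong (_+ # (not ∘ P)) (sym #P≡n)) (trans (#-+-#-not P) (sym (+-identityʳ n))))

#-singletonˡ : ∀ {n} (x : Fin n) → # (x ==_) ≡ 1
#-singletonˡ x = trans (#-cong (==-comm x)) (#-singleton x)

sum-indicator : ∀ {t} (f : Fin t → ℕ) (x : Fin t) → sum (λ u → f u * [ x == u ]) ≡ f x
sum-indicator {suc t} f x = begin
  sum (λ u → f u * [ x == u ])                                 ≡⟨ sum-remove {i = x} (λ u → f u * [ x == u ]) ⟩
  f x * [ x == x ] + sum (λ u → f (punchIn x u) * [ x == punchIn x u ])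
    ≡⟨ cong₂ _+_ (cong (λ b → f x * [ b ]) (==-refl x))
                 (sum-cong-≗ (λ u → cong (λ b → f (punchIn x u) * [ b ]) (==-≢ (punchInᵢ≢i x u ∘ sym)))) ⟩
  f x * 1 + sum (λ u → f (punchIn x u) * 0)                    ≡⟨ cong₂ _+_ (*-identityʳ (f x))
                                                                     (sum-cong-≗ (λ u → *-zeroʳ (f (punchIn x u)))) ⟩
  f x + sum {t} (λ _ → 0)                                      ≡⟨ cong (f x +_) (trans (sum-const t 0) (*-zeroʳ t)) ⟩
  f x + 0                                                      ≡⟨ +-identityʳ (f x) ⟩
  f x                                                          ∎
  where open ≡-Reasoning

fibre : ∀ {n t} → (Fin n → Fin t) → Fin t → ℕ
fibre c u = # (λ j → c j == u)

sum-fibre : ∀ {n t} (c : Fin n → Fin t) → sum (fibre c) ≡ n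
sum-fibre {n} c = begin
  sum (λ u → sum (λ j → [ c j == u ])) ≡⟨ ∑-comm (λ u j → [ c j == u ]) ⟩
  sum (λ j → # (c j ==_))              ≡⟨ sum-cong-≗ (#-singletonˡ ∘ c) ⟩
  sum {n} (λ _ → 1)                    ≡⟨ sum-const n 1 ⟩
  n * 1                                ≡⟨ *-identityʳ n ⟩
  n                                    ∎
  where open ≡-Reasoning

sum-by-fibre : ∀ {n t} (val : Fin t → ℕ) (c : Fin n → Fin t) → sum (val ∘ c) ≡ sum (λ u → val u * fibre c u)
sum-by-fibre val c = begin
  sum (val ∘ c)                                ≡⟨ sum-cong-≗ (sum-indicator val ∘ c) ⟨
  sum (λ j → sum (λ u → val u * [ c j == u ])) ≡⟨ ∑-comm (λ j u → val u * [ c j == u ]) ⟩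
  sum (λ u → sum (λ j → val u * [ c j == u ])) ≡⟨ sum-cong-≗ (λ u → *-distribˡ-sum (val u) (λ j → [ c j == u ])) ⟨
  sum (λ u → val u * fibre c u)                ∎
  where open ≡-Reasoning

fibres-agree : ∀ {n t} (c c′ : Fin n → Fin (suc t)) (u₀ : Fin (suc t)) →
  (∀ u → u ≢ u₀ → fibre c u ≡ fibre c′ u) → ∀ u → fibre c u ≡ fibre c′ u
fibres-agree c c′ u₀ agree u with u ≟ u₀
... | no u≢u₀  = agree u u≢u₀
... | yes refl = +-cancelʳ-≡ _ _ _ (begin
  fibre c u₀ + sum (fibre c ∘ punchIn u₀)   ≡⟨ sum-remove {i = u₀} (fibre c) ⟨
  sum (fibre c)                             ≡⟨ trans (sum-fibre c) (sym (sum-fibre c′)) ⟩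
  sum (fibre c′)                            ≡⟨ sum-remove {i = u₀} (fibre c′) ⟩
  fibre c′ u₀ + sum (fibre c′ ∘ punchIn u₀) ≡⟨ cong (fibre c′ u₀ +_)
                                                 (sum-cong-≗ (λ v → sym (agree _ (punchInᵢ≢i u₀ v)))) ⟩
  fibre c′ u₀ + sum (fibre c ∘ punchIn u₀)  ∎)
  where open ≡-Reasoning

fibre-onto : ∀ {n t} (c : Fin n → Fin t) {u} → 1 ≤ fibre c u → ∃ λ i → c i ≡ u
fibre-onto c 1≤fibre = let i , ci==u = 1≤#⇒∃ _ 1≤fibre in i , ==⇒≡ ci==u

-- Match the first player's class with some player of the same class under c′, then recurse.
equal-fibres⇒permutation : ∀ {t} n (c c′ : Fin n → Fin t) → (∀ u → fibre c u ≡ fibre c′ u) →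
  Σ (Permutation′ n) λ σ → ∀ x → c′ (σ ⟨$⟩ʳ x) ≡ c x
equal-fibres⇒permutation zero    c c′ same = Perm.id , λ ()
equal-fibres⇒permutation (suc n) c c′ same = insert fzero j σ , matches
  where
  found = 1≤#⇒∃ (λ k → c′ k == c fzero)
            (subst (1 ≤_) (same (c fzero)) (∃⇒1≤# (λ k → c k == c fzero) (==-refl (c fzero))))
  j = proj₁ found
  c′j≡c0 : c′ j ≡ c fzero
  c′j≡c0 = ==⇒≡ (proj₂ found)
  same′ : ∀ u → fibre (c ∘ fsuc) u ≡ fibre (c′ ∘ punchIn j) u
  same′ u = +-cancelˡ-≡ [ c fzero == u ] _ _ (begin
    fibre c u                 ≡⟨ same u ⟩
    fibre c′ u                ≡⟨ #-remove (λ k → c′ k == u) j ⟩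
    [ c′ j == u ] + others    ≡⟨ cong (λ x → [ x == u ] + others) c′j≡c0 ⟩
    [ c fzero == u ] + others ∎)
    where
    open ≡-Reasoning
    others = fibre (c′ ∘ punchIn j) u
  recursion = equal-fibres⇒permutation n (c ∘ fsuc) (c′ ∘ punchIn j) same′
  σ = proj₁ recursion
  matches : ∀ x → c′ (insert fzero j σ ⟨$⟩ʳ x) ≡ c x
  matches fzero    = c′j≡c0
  matches (fsuc k) = trans (cong c′ (insert-punchIn fzero j σ k)) (proj₂ recursion k)

#-∨ : ∀ {n} (P Q : Fin n → Bool) → (∀ i → P i ≡ true → Q i ≡ false) → # (λ i → P i ∨ Q i) ≡ # P + # Q
#-∨ P Q disjoint =
  trans (sum-cong-≗ (λ i → [∨] (P i) (Q i) (disjoint i))) (∑-distrib-+ (λ i → [ P i ]) (λ i → [ Q i ]))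
  where
  [∨] : ∀ a b → (a ≡ true → b ≡ false) → [ a ∨ b ] ≡ [ a ] + [ b ]
  [∨] true  b a⇒¬b rewrite a⇒¬b refl = refl
  [∨] false b _ = refl

#-toℕ< : ∀ {n} p → p ≤ n → # (λ (i : Fin n) → toℕ i <ᵇ p) ≡ p
#-toℕ< {zero}  zero    _         = refl
#-toℕ< {suc n} zero    _         = trans (sum-const n 0) (*-zeroʳ n)
#-toℕ< {suc n} (suc p) (s≤s p≤n) = cong suc (#-toℕ< p p≤n)

#-toℕ≥ : ∀ {n} p → p ≤ n → # (λ (i : Fin n) → not (toℕ i <ᵇ p)) ≡ n ∸ p
#-toℕ≥ {n} p p≤n = begin
  # (not ∘ below)               ≡⟨ m+n∸m≡n p _ ⟨
  p + # (not ∘ below) ∸ p       ≡⟨ cong (λ k → k + # (not ∘ below) ∸ p) (#-toℕ< p p≤n) ⟨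
  # below + # (not ∘ below) ∸ p ≡⟨ cong (_∸ p) (#-+-#-not below) ⟩
  n ∸ p                         ∎
  where
  open ≡-Reasoning
  below : Fin n → Bool
  below i = toℕ i <ᵇ p

≤ᵇ-true : ∀ {m n} → m ≤ n → (m ≤ᵇ n) ≡ true
≤ᵇ-true {m} {n} = dec-true (m ≤? n)

≤ᵇ-false : ∀ {m n} → ¬ m ≤ n → (m ≤ᵇ n) ≡ false
≤ᵇ-false {m} {n} = dec-false (m ≤? n)

≤ᵇ-sound : ∀ {m n} → (m ≤ᵇ n) ≡ true → m ≤ n
≤ᵇ-sound {m} {n} e = ≤ᵇ⇒≤ m n (subst T (sym e) tt)

split : ∀ {n} → (Fin n → Bool) → Fin n → Fin 2
split P i = if P i then 1F else 0F

-- The weight vectors of the statement list the players by decreasing weight; layer₂ and layer₃ give the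
-- class of each position.
layer₂ : ∀ {n} → ℕ → Fin n → Fin 2
layer₂ p i = if toℕ i <ᵇ p then 0F else 1F

fibre-split : ∀ {n} (P : Fin n → Bool) → fibre (split P) 1F ≡ # P
fibre-split P = #-cong (λ i → lemma (P i))
  where
  lemma : ∀ b → _==_ {2} (if b then 1F else 0F) 1F ≡ b
  lemma true  = refl
  lemma false = refl

fibre-layer₂ : ∀ {n} p → p ≤ n → fibre (layer₂ {n} p) 1F ≡ n ∸ p
fibre-layer₂ {n} p p≤n = trans (#-cong {n} (λ i → lemma (toℕ i <ᵇ p))) (#-toℕ≥ p p≤n)
  where
  lemma : ∀ b → _==_ {2} (if b then 0F else 1F) 1F ≡ not b
  lemma true  = refl
  lemma false = refl

fibre₂-sum : ∀ {n} (c : Fin n → Fin 2) → fibre c 0F + fibre c 1F ≡ n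
fibre₂-sum c = trans (cong (fibre c 0F +_) (sym (+-identityʳ (fibre c 1F)))) (sum-fibre c)

fibres-agree₂ : ∀ {n} (c c′ : Fin n → Fin 2) → fibre c 1F ≡ fibre c′ 1F → ∀ u → fibre c u ≡ fibre c′ u
fibres-agree₂ c c′ same = fibres-agree c c′ 0F λ where
  0F 0≢0 → ⊥-elim (0≢0 refl)
  1F _   → same

layer₃ : ∀ {n} → ℕ → ℕ → Fin n → Fin 3
layer₃ p r i = if toℕ i <ᵇ p then 0F else (if toℕ i <ᵇ r then 1F else 2F)

fibre-layer₃-0F : ∀ {n} p r → p ≤ n → fibre (layer₃ {n} p r) 0F ≡ p
fibre-layer₃-0F {n} p r p≤n = trans (#-cong {n} (λ i → lemma (toℕ i <ᵇ p) (toℕ i <ᵇ r))) (#-toℕ< p p≤n)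
  where
  lemma : ∀ b c → _==_ {3} (if b then 0F else (if c then 1F else 2F)) 0F ≡ b
  lemma true  c     = refl
  lemma false true  = refl
  lemma false false = refl

fibre-layer₃-2F : ∀ {n} p r → p ≤ r → r ≤ n → fibre (layer₃ {n} p r) 2F ≡ n ∸ r
fibre-layer₃-2F {n} p r p≤r r≤n =
  trans (#-cong {n} (λ i → lemma (toℕ i <ᵇ p) (toℕ i <ᵇ r) (below-r (toℕ i)))) (#-toℕ≥ r r≤n)
  where
  below-r : ∀ m → (m <ᵇ p) ≡ true → (m <ᵇ r) ≡ true
  below-r m m<p = ≤ᵇ-true (≤-trans (≤ᵇ-sound m<p) p≤r)
  lemma : ∀ b c → (b ≡ true → c ≡ true) → _==_ {3} (if b then 0F else (if c then 1F else 2F)) 2F ≡ not c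
  lemma true  c b⇒c rewrite b⇒c refl = refl
  lemma false true  _ = refl
  lemma false false _ = refl

fibres-agree₃ : ∀ {n} (c c′ : Fin n → Fin 3) → fibre c 0F ≡ fibre c′ 0F → fibre c 2F ≡ fibre c′ 2F →
  ∀ u → fibre c u ≡ fibre c′ u
fibres-agree₃ c c′ same₀ same₂ = fibres-agree c c′ 1F λ where
  0F _   → same₀
  1F 1≢1 → ⊥-elim (1≢1 refl)
  2F _   → same₂

_∋_ : ∀ {n} → Subset n → Fin n → Set
S ∋ i = lookup S i ≡ true

_∌_ : ∀ {n} → Subset n → Fin n → Set
S ∌ i = lookup S i ≡ false

_⊆_ : ∀ {n} → Subset n → Subset n → Set
S ⊆ T = ∀ i → S ∋ i → T ∋ i

Distinct₃ : ∀ {n} → Fin n → Fin n → Fin n → Set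
Distinct₃ x y z = x ≢ y × x ≢ z × y ≢ z

∌⇒≢ : ∀ {n} (S : Subset n) {i x} → S ∌ x → S ∋ i → i ≢ x
∌⇒≢ S S∌x S∋i refl with () ← trans (sym S∌x) S∋i

allBut : ∀ {n} → Fin n → Subset n
allBut x = full [ x ]≔ false

allBut₂ : ∀ {n} → Fin n → Fin n → Subset n
allBut₂ x y = allBut x [ y ]≔ false

allBut₃ : ∀ {n} → Fin n → Fin n → Fin n → Subset n
allBut₃ x y z = allBut₂ x y [ z ]≔ false

full∋ : ∀ {n} (i : Fin n) → full ∋ i
full∋ i = lookup-replicate i true

allBut∌ : ∀ {n} (x : Fin n) → allBut x ∌ x
allBut∌ x = lookup∘update x full false

allBut∋ : ∀ {n} {x i : Fin n} → i ≢ x → allBut x ∋ i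
allBut∋ {i = i} i≢x = trans (lookup∘update′ i≢x full false) (full∋ i)

allBut₂∌ˡ : ∀ {n} {x y : Fin n} → x ≢ y → allBut₂ x y ∌ x
allBut₂∌ˡ {x = x} x≢y = trans (lookup∘update′ x≢y (allBut x) false) (allBut∌ x)

allBut₂∌ʳ : ∀ {n} (x y : Fin n) → allBut₂ x y ∌ y
allBut₂∌ʳ x y = lookup∘update y (allBut x) false

allBut₂∋ : ∀ {n} {x y i : Fin n} → i ≢ x → i ≢ y → allBut₂ x y ∋ i
allBut₂∋ {x = x} i≢x i≢y = trans (lookup∘update′ i≢y (allBut x) false) (allBut∋ i≢x)

allBut₃∋ : ∀ {n} {x y z i : Fin n} → i ≢ x → i ≢ y → i ≢ z → allBut₃ x y z ∋ i
allBut₃∋ {x = x} {y} i≢x i≢y i≢z = trans (lookup∘update′ i≢z (allBut₂ x y) false) (allBut₂∋ i≢x i≢y)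

allBut₂-comm : ∀ {n} {x y : Fin n} → x ≢ y → allBut₂ x y ≡ allBut₂ y x
allBut₂-comm {x = x} {y} = []≔-commutes full x y

⊆-allBut : ∀ {n} (S : Subset n) {x} → S ∌ x → S ⊆ allBut x
⊆-allBut S {x} S∌x i S∋i = allBut∋ {x = x} (∌⇒≢ S S∌x S∋i)

⊆-allBut₂ : ∀ {n} (S : Subset n) {x y} → S ∌ x → S ∌ y → S ⊆ allBut₂ x y
⊆-allBut₂ S {x} {y} S∌x S∌y i S∋i = allBut₂∋ {x = x} {y} (∌⇒≢ S S∌x S∋i) (∌⇒≢ S S∌y S∋i)

⊆-allBut₃ : ∀ {n} (S : Subset n) {x y z} → S ∌ x → S ∌ y → S ∌ z → S ⊆ allBut₃ x y z
⊆-allBut₃ S {x} {y} {z} S∌x S∌y S∌z i S∋i =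
  allBut₃∋ {x = x} {y} {z} (∌⇒≢ S S∌x S∋i) (∌⇒≢ S S∌y S∋i) (∌⇒≢ S S∌z S∋i)

data CoalitionShape {n} : Subset n → Set where
  everyone     : CoalitionShape full
  all-but-one  : ∀ x → CoalitionShape (allBut x)
  all-but-two  : ∀ {x y} → x ≢ y → CoalitionShape (allBut₂ x y)
  misses-three : ∀ {S x y z} → Distinct₃ x y z → S ∌ x → S ∌ y → S ∌ z → CoalitionShape S

coalitionShape : ∀ {n} (S : Subset n) → CoalitionShape S
coalitionShape []      = everyone
coalitionShape (b ∷ S) = extend b (coalitionShape S)
  where
  0≢s : ∀ {n} {x : Fin n} → fzero ≢ fsuc x
  0≢s ()
  extend : ∀ {n} {S : Subset n} b → CoalitionShape S → CoalitionShape (b ∷ S)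
  extend true  everyone          = everyone
  extend false everyone          = all-but-one fzero
  extend true  (all-but-one x)   = all-but-one (fsuc x)
  extend false (all-but-one x)   = all-but-two (0≢s {x = x})
  extend true  (all-but-two x≢y) = all-but-two (x≢y ∘ suc-injective)
  extend false (all-but-two {x} {y} x≢y) =
    misses-three (0≢s , 0≢s , x≢y ∘ suc-injective) refl (allBut₂∌ˡ x≢y) (allBut₂∌ʳ x y)
  extend b (misses-three (x≢y , x≢z , y≢z) S∌x S∌y S∌z) =
    misses-three (x≢y ∘ suc-injective , x≢z ∘ suc-injective , y≢z ∘ suc-injective) S∌x S∌y S∌z

winning-nonempty : ∀ {n} (G : SimpleGame n) {S} → win G S ≡ true → ∃ λ i → S ∋ i
winning-nonempty G {S} S-wins with any? (λ i → lookup S i Bool.≟ true)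
... | yes S∋i = S∋i
... | no  ∄i  with () ← trans (sym (empty-los G)) (monotone G S ∅ (λ i S∋i → ⊥-elim (∄i (i , S∋i))) S-wins)

weightOf-sum : ∀ {n} (S : Subset n) (w : Fin n → ℕ) → weightOf S w ≡ sum (λ i → if lookup S i then w i else 0)
weightOf-sum []      w = refl
weightOf-sum (b ∷ S) w = cong ((if b then w fzero else 0) +_) (weightOf-sum S (w ∘ fsuc))

weightOf-full : ∀ {n} (w : Fin n → ℕ) → weightOf full w ≡ sum w
weightOf-full w = trans (weightOf-sum full w) (sum-cong-≗ (λ i → cong (λ b → if b then w i else 0) (full∋ i)))

weightOf-cong : ∀ {n} (S : Subset n) {w w′ : Fin n → ℕ} → (∀ i → w i ≡ w′ i) →
  weightOf S w ≡ weightOf S w′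
weightOf-cong S w≗w′ = trans (weightOf-sum S _)
  (trans (sum-cong-≗ (λ i → cong (if lookup S i then_else 0) (w≗w′ i))) (sym (weightOf-sum S _)))

weightOf-mono : ∀ {n} (S T : Subset n) (w : Fin n → ℕ) → S ⊆ T → weightOf S w ≤ weightOf T w
weightOf-mono []      []      w S⊆T = z≤n
weightOf-mono (a ∷ S) (b ∷ T) w S⊆T =
  +-mono-≤ (head-mono a b (S⊆T fzero)) (weightOf-mono S T (w ∘ fsuc) (S⊆T ∘ fsuc))
  where
  head-mono : ∀ a b → (a ≡ true → b ≡ true) → (if a then w fzero else 0) ≤ (if b then w fzero else 0)
  head-mono true  b a⇒b rewrite a⇒b refl = ≤-refl
  head-mono false b a⇒b = z≤n

weightOf-remove : ∀ {n} (S : Subset n) {x} (w : Fin n → ℕ) → S ∋ x →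
  weightOf (S [ x ]≔ false) w + w x ≡ weightOf S w
weightOf-remove (true ∷ S) {fzero}  w refl = +-comm (weightOf S (w ∘ fsuc)) (w fzero)
weightOf-remove (b ∷ S)    {fsuc x} w S∋x =
  trans (+-assoc (if b then w fzero else 0) _ _)
        (cong ((if b then w fzero else 0) +_) (weightOf-remove S (w ∘ fsuc) S∋x))

weightOf-insert : ∀ {n} (S : Subset n) {x} (w : Fin n → ℕ) → S ∌ x →
  weightOf (S [ x ]≔ true) w ≡ weightOf S w + w x
weightOf-insert (false ∷ S) {fzero}  w refl = +-comm (w fzero) _
weightOf-insert (b ∷ S)     {fsuc x} w S∌x =
  trans (cong ((if b then w fzero else 0) +_) (weightOf-insert S (w ∘ fsuc) S∌x))
        (sym (+-assoc (if b then w fzero else 0) _ _))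

weightOf-exchange : ∀ {n} (S : Subset n) {i j} (w : Fin n → ℕ) → S ∋ j → S ∌ i →
  weightOf ((S [ j ]≔ false) [ i ]≔ true) w + w j ≡ weightOf S w + w i
weightOf-exchange S {i} {j} w S∋j S∌i = begin
  weightOf (S′ [ i ]≔ true) w + w j ≡⟨ cong (_+ w j) (weightOf-insert S′ w S′∌i) ⟩
  weightOf S′ w + w i + w j         ≡⟨ +-assoc (weightOf S′ w) (w i) (w j) ⟩
  weightOf S′ w + (w i + w j)       ≡⟨ cong (weightOf S′ w +_) (+-comm (w i) (w j)) ⟩
  weightOf S′ w + (w j + w i)       ≡⟨ +-assoc (weightOf S′ w) (w j) (w i) ⟨
  weightOf S′ w + w j + w i         ≡⟨ cong (_+ w i) (weightOf-remove S w S∋j) ⟩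
  weightOf S w + w i                ∎
  where
  open ≡-Reasoning
  S′ = S [ j ]≔ false
  S′∌i : S′ ∌ i
  S′∌i = trans (lookup∘update′ (∌⇒≢ S S∌i S∋j ∘ sym) S false) S∌i

weightOf-allBut : ∀ {n} (w : Fin n → ℕ) x → weightOf (allBut x) w + w x ≡ sum w
weightOf-allBut w x = trans (weightOf-remove full w (full∋ x)) (weightOf-full w)

weightOf-allBut₂ : ∀ {n} (w : Fin n → ℕ) {x y} → x ≢ y → weightOf (allBut₂ x y) w + (w x + w y) ≡ sum w
weightOf-allBut₂ w {x} {y} x≢y = begin
  weightOf (allBut₂ x y) w + (w x + w y) ≡⟨ shuffle (weightOf (allBut₂ x y) w) (w x) (w y) ⟩
  weightOf (allBut₂ x y) w + w y + w x   ≡⟨ cong (_+ w x) (weightOf-remove (allBut x) w (allBut∋ (x≢y ∘ sym))) ⟩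
  weightOf (allBut x) w + w x            ≡⟨ weightOf-allBut w x ⟩
  sum w                                  ∎
  where
  open ≡-Reasoning
  shuffle : ∀ a b c → a + (b + c) ≡ a + c + b
  shuffle = solve-∀

weightOf-allBut₃ : ∀ {n} (w : Fin n → ℕ) {x y z} → Distinct₃ x y z →
  weightOf (allBut₃ x y z) w + (w x + w y + w z) ≡ sum w
weightOf-allBut₃ w {x} {y} {z} (x≢y , x≢z , y≢z) = begin
  weightOf (allBut₃ x y z) w + (w x + w y + w z) ≡⟨ shuffle (weightOf (allBut₃ x y z) w) (w x + w y) (w z) ⟩
  weightOf (allBut₃ x y z) w + w z + (w x + w y) ≡⟨ cong (_+ (w x + w y))
                                                     (weightOf-remove (allBut₂ x y) w (allBut₂∋ (x≢z ∘ sym) (y≢z ∘ sym))) ⟩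
  weightOf (allBut₂ x y) w + (w x + w y)         ≡⟨ weightOf-allBut₂ w x≢y ⟩
  sum w                                          ∎
  where
  open ≡-Reasoning
  shuffle : ∀ a b c → a + (b + c) ≡ a + c + b
  shuffle = solve-∀

weightOf-permute : ∀ {n} (π : Permutation′ n) (S : Subset n) (w : Fin n → ℕ) →
  weightOf (tabulate (λ i → lookup S (π ⟨$⟩ʳ i))) w ≡ weightOf S (λ j → w (π ⟨$⟩ˡ j))
weightOf-permute π S w = begin
  weightOf πS w
    ≡⟨ weightOf-sum πS w ⟩
  sum (λ i → if lookup πS i then w i else 0)
    ≡⟨ sum-cong-≗ (λ i → cong₂ (λ b m → if b then m else 0)
                            (lookup∘tabulate (λ i → lookup S (π ⟨$⟩ʳ i)) i) (cong w (sym (inverseˡ π)))) ⟩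
  sum (λ i → f (π ⟨$⟩ʳ i))
    ≡⟨ sum-permute f π ⟨
  sum f
    ≡⟨ weightOf-sum S _ ⟨
  weightOf S (λ j → w (π ⟨$⟩ˡ j))
    ∎
  where
  open ≡-Reasoning
  πS = tabulate (λ i → lookup S (π ⟨$⟩ʳ i))
  f : Fin _ → ℕ
  f j = if lookup S j then w (π ⟨$⟩ˡ j) else 0

balance-≤ : ∀ {W m q d} → W + m ≡ q + d → q ≤ W → m ≤ d
balance-≤ {W} {m} {q} {d} e q≤W = +-cancelˡ-≤ q m d (subst (q + m ≤_) e (+-monoˡ-≤ m q≤W))

balance-≥ : ∀ {W m q d} → W + m ≡ q + d → m ≤ d → q ≤ W
balance-≥ {W} {m} {q} {d} e m≤d = +-cancelʳ-≤ m q W (subst (q + m ≤_) (sym e) (+-monoʳ-≤ q m≤d))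

-- The shape of a game with ν ≥ n - 1: everything but the coalitions N ∖ {x, y} is decided.
record PairDetermined {n} (G : SimpleGame n) : Set where
  field
    allBut-wins        : ∀ x → win G (allBut x) ≡ true
    misses-three-loses : ∀ {S x y z} → Distinct₃ x y z → S ∌ x → S ∌ y → S ∌ z → win G S ≡ false

record PairThreshold {n} (G : SimpleGame n) (v : Fin n → ℕ) (d : ℕ) : Set where
  field
    below-threshold : ∀ x → v x ≤ d
    pair-wins       : ∀ {x y} → x ≢ y → win G (allBut₂ x y) ≡ (v x + v y ≤ᵇ d)
    triple-exceeds  : ∀ {x y z} → Distinct₃ x y z → d < v x + v y + v z

weighted-by-threshold : ∀ {n} {G : SimpleGame n} {v d} q → PairDetermined G → PairThreshold G v d →
  q + d ≡ sum v → ∀ S → win G S ≡ weighted q v S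
weighted-by-threshold {G = G} {v} {d} q pd th total S with coalitionShape S
... | everyone =
  trans (full-win G) (sym (≤ᵇ-true (subst (q ≤_) (trans total (sym (weightOf-full v))) (m≤m+n q d))))
... | all-but-one x =
  trans (allBut-wins x) (sym (≤ᵇ-true (balance-≥ (trans (weightOf-allBut v x) (sym total)) (below-threshold x))))
  where open PairDetermined pd ; open PairThreshold th
... | all-but-two x≢y =
  trans (pair-wins x≢y) (does-⇔ (mk⇔ (balance-≥ balance) (balance-≤ balance)) (_ ≤? d) (q ≤? _))
  where
  open PairThreshold th
  balance = trans (weightOf-allBut₂ v x≢y) (sym total)
... | misses-three {x = x} {y} {z} distinct S∌x S∌y S∌z =
  trans (misses-three-loses distinct S∌x S∌y S∌z) (sym (≤ᵇ-false λ q≤S →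
    <⇒≱ (triple-exceeds distinct) (balance-≤ (trans (weightOf-allBut₃ v distinct) (sym total))
      (≤-trans q≤S (weightOf-mono S (allBut₃ x y z) v (⊆-allBut₃ S S∌x S∌y S∌z))))))
  where open PairDetermined pd ; open PairThreshold th

isoTo-weighted : ∀ {n} {G : SimpleGame n} {q} {v w : Fin n → ℕ} (σ : Permutation′ n) →
  (∀ x → w (σ ⟨$⟩ʳ x) ≡ v x) → (∀ S → win G S ≡ weighted q v S) → IsoTo G (weighted q w)
isoTo-weighted {q = q} {v} {w} σ w∘σ≗v is-weighted = flip σ , λ S → trans (is-weighted S)
  (cong (q ≤ᵇ_) (sym (trans (weightOf-permute (flip σ) S w) (weightOf-cong S w∘σ≗v))))

Separated : ∀ {n} → (Fin n → ℕ) → ℕ → Set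
Separated v d = ∀ i j → v i < v j → ∃ λ z → z ≢ i × z ≢ j × v i + v z ≤ d × d < v j + v z

module _ {n} {G : SimpleGame n} {q} {v : Fin n → ℕ} (is-weighted : ∀ S → win G S ≡ weighted q v S) where

  heavier⇒desirable : ∀ i j → v j ≤ v i → Desir G i j
  heavier⇒desirable i j vj≤vi S S∋j S∌i S-wins = trans (is-weighted _) (≤ᵇ-true (≤-trans q≤S
    (+-cancelʳ-≤ (v j) _ _ (subst (weightOf S v + v j ≤_) (sym (weightOf-exchange S v S∋j S∌i))
                                  (+-monoʳ-≤ _ vj≤vi)))))
    where
    q≤S : q ≤ weightOf S v
    q≤S = ≤ᵇ-sound (trans (sym (is-weighted S)) S-wins)

  -- N ∖ {i, z} wins but N ∖ {j, z} loses, and exchanging i for j in the first turns it into the second.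
  separated⇒¬desirable : ∀ {d} → q + d ≡ sum v → Separated v d → ∀ i j → v i < v j → ¬ Desir G i j
  separated⇒¬desirable {d} total separated i j vi<vj i⊒j
    with z , z≢i , z≢j , vi+vz≤d , d<vj+vz ← separated i j vi<vj =
    <⇒≱ d<vj+vz (balance-≤ balance q≤S′)
    where
    i≢j : i ≢ j
    i≢j refl = <-irrefl refl vi<vj
    S = allBut₂ i z
    S′ = (S [ j ]≔ false) [ i ]≔ true
    S-wins : win G S ≡ true
    S-wins = trans (is-weighted S)
      (≤ᵇ-true (balance-≥ (trans (weightOf-allBut₂ v (z≢i ∘ sym)) (sym total)) vi+vz≤d))
    q≤S′ : q ≤ weightOf S′ v
    q≤S′ = ≤ᵇ-sound (trans (sym (is-weighted S′))
      (i⊒j S (allBut₂∋ (i≢j ∘ sym) (z≢j ∘ sym)) (allBut₂∌ˡ (z≢i ∘ sym)) S-wins))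
    balance : weightOf S′ v + (v j + v z) ≡ q + d
    balance = begin
      weightOf S′ v + (v j + v z) ≡⟨ +-assoc (weightOf S′ v) (v j) (v z) ⟨
      weightOf S′ v + v j + v z   ≡⟨ cong (_+ v z) (weightOf-exchange S v (allBut₂∋ (i≢j ∘ sym) (z≢j ∘ sym))
                                                                         (allBut₂∌ˡ (z≢i ∘ sym))) ⟩
      weightOf S v + v i + v z    ≡⟨ +-assoc (weightOf S v) (v i) (v z) ⟩
      weightOf S v + (v i + v z)  ≡⟨ trans (weightOf-allBut₂ v (z≢i ∘ sym)) (sym total) ⟩
      q + d                       ∎
      where open ≡-Reasoning

record WeightedForm {n} (G : SimpleGame n) (t : ℕ) : Set where
  field
    class           : Fin n → Fin t
    value           : Fin t → ℕ
    value-injective : ∀ u u′ → value u ≡ value u′ → u ≡ u′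
    class-onto      : ∀ u → ∃ λ i → class i ≡ u
    quota threshold : ℕ
    total           : quota + threshold ≡ sum (value ∘ class)
    pairs           : PairThreshold G (value ∘ class) threshold
    separated       : Separated (value ∘ class) threshold

module _ {n t} {G : SimpleGame n} (pd : PairDetermined G) (F : WeightedForm G t) where
  open WeightedForm F

  is-weighted : ∀ S → win G S ≡ weighted quota (value ∘ class) S
  is-weighted = weighted-by-threshold quota pd pairs total

  private
    v = value ∘ class
    desirable = heavier⇒desirable {G = G} {quota} {v} is-weighted
    ¬desirable = separated⇒¬desirable {G = G} {quota} {v} is-weighted total separated

  numClasses : NumClasses G t
  numClasses = class , class-onto , λ i j → mk⇔
    (λ ci≡cj → desirable i j (≤-reflexive (cong value (sym ci≡cj))) , desirable j i (≤-reflexive (cong value ci≡cj)))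
    (λ i≈j → value-injective _ _ (equal-value i≈j))
    where
    equal-value : ∀ {i j} → Equivalent G i j → v i ≡ v j
    equal-value {i} {j} (i⊒j , j⊒i) with <-cmp (v i) (v j)
    ... | tri< vi<vj _ _ = ⊥-elim (¬desirable i j vi<vj i⊒j)
    ... | tri≈ _ vi≡vj _ = vi≡vj
    ... | tri> _ _ vj<vi = ⊥-elim (¬desirable j i vj<vi j⊒i)

  recognise : (layout : Fin n → Fin t) (w : Fin n → ℕ) → (∀ i → w i ≡ value (layout i)) →
    (∀ u → fibre class u ≡ fibre layout u) → IsoTo G (weighted quota w) × NumClasses G t
  recognise layout w w≗layout same-fibres =
    isoTo-weighted {G = G} {quota} {v} σ (λ x → trans (w≗layout _) (cong value (σ-matches x))) is-weighted ,
    numClasses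
    where
    σ = proj₁ (equal-fibres⇒permutation n class layout same-fibres)
    σ-matches = proj₂ (equal-fibres⇒permutation n class layout same-fibres)

HasFamily : ∀ {n} → SimpleGame n → ℕ → Set
HasFamily {n} G m = ∃ λ (L : List (Subset n)) → length L ≡ m × WinningEmptyFamily G L

FamiliesAtLeast : ∀ {n} → SimpleGame n → ℕ → Set
FamiliesAtLeast {n} G m = ∀ (L : List (Subset n)) → WinningEmptyFamily G L → m ≤ length L

family⇒allBut-wins : ∀ {n m} (G : SimpleGame n) → HasFamily G m → ∀ x → win G (allBut x) ≡ true
family⇒allBut-wins G (L , _ , wins , no-common) x =
  let S-wins , S∌x = lookupAny wins (no-common x) in monotone G S (allBut x) (⊆-allBut S S∌x) S-wins
  where S = Any.lookup (no-common x)

-- Fewer than n coalitions cover n players, so some coalition misses two of them.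
family⇒edge : ∀ {n} (G : SimpleGame (suc n)) → HasFamily G n →
  ∃₂ λ x y → x ≢ y × win G (allBut₂ x y) ≡ true
family⇒edge {n} G (L , length≡n , wins , no-common)
  with x , y , x<y , same ← pigeonhole (subst (_< suc n) (sym length≡n) ≤-refl) (λ i → Any.index (no-common i)) =
  x , y , <⇒≢ᶠ x<y , monotone G S (allBut₂ x y) (⊆-allBut₂ S S∌x S∌y) S-wins
  where
  S = Any.lookup (no-common x)
  S-wins = proj₁ (lookupAny wins (no-common x))
  S∌x = proj₂ (lookupAny wins (no-common x))
  S∌y : S ∌ y
  S∌y = subst (λ k → lookup (lookupˡ L k) y ≡ false) (sym same) (proj₂ (lookupAny wins (no-common y)))

covering-bound : ∀ {n m₀} (G : SimpleGame n) → FamiliesAtLeast G m₀ → ∀ m (g : Fin m → Subset n) →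
  (∀ t → win G (g t) ≡ true) → (∀ u → ∃ λ t → g t ∌ u) → m₀ ≤ m
covering-bound G atLeast m g wins covers = subst (_ ≤_) (length-tabulate g)
  (atLeast (tabulateˡ g) (All.tabulate⁺ wins , λ u → Any.tabulate⁺ (proj₁ (covers u)) (proj₂ (covers u))))

punchIn-onto : ∀ {n} {x w : Fin (suc n)} → w ≢ x → ∃ λ t → punchIn x t ≡ w
punchIn-onto w≢x = punchOut (w≢x ∘ sym) , punchIn-punchOut (w≢x ∘ sym)

punchIn₂-onto : ∀ {n} {x y w : Fin (suc (suc n))} (x≢y : x ≢ y) → w ≢ x → w ≢ y →
  ∃ λ t → punchIn x (punchIn (punchOut x≢y) t) ≡ w
punchIn₂-onto {x = x} {y} {w} x≢y w≢x w≢y =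
  let t , x[t]≡w = punchIn-onto w≢x
      t′ , y[t′]≡t = punchIn-onto {x = punchOut x≢y} (t≢y′ t x[t]≡w)
  in t′ , trans (cong (punchIn x) y[t′]≡t) x[t]≡w
  where
  t≢y′ : ∀ t → punchIn x t ≡ w → t ≢ punchOut x≢y
  t≢y′ t x[t]≡w t≡y′ = w≢y (trans (sym x[t]≡w) (trans (cong (punchIn x) t≡y′) (punchIn-punchOut x≢y)))

module _ {n m₀} (G : SimpleGame (suc n)) (atLeast : FamiliesAtLeast G m₀)
         (g : Fin (suc n) → Subset (suc n)) (wins : ∀ w → win G (g w) ≡ true) where

  covering-avoiding₁ : ∀ x → (∀ u → ∃ λ w → w ≢ x × g w ∌ u) → m₀ ≤ n
  covering-avoiding₁ x covers = covering-bound G atLeast n (g ∘ punchIn x) (wins ∘ punchIn x) λ u →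
    let w , w≢x , gw∌u = covers u ; t , x[t]≡w = punchIn-onto w≢x
    in t , subst (λ w → g w ∌ u) (sym x[t]≡w) gw∌u

module _ {n m₀} (G : SimpleGame (suc (suc n))) (atLeast : FamiliesAtLeast G m₀)
         (g : Fin (suc (suc n)) → Subset (suc (suc n))) (wins : ∀ w → win G (g w) ≡ true) where

  covering-avoiding₂ : ∀ {x y} → x ≢ y → (∀ u → ∃ λ w → w ≢ x × w ≢ y × g w ∌ u) → m₀ ≤ n
  covering-avoiding₂ {x} x≢y covers =
    covering-bound G atLeast n (g ∘ e) (wins ∘ e) λ u →
      let w , w≢x , w≢y , gw∌u = covers u ; t , e[t]≡w = punchIn₂-onto x≢y w≢x w≢y
      in t , subst (λ w → g w ∌ u) (sym e[t]≡w) gw∌u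
    where
    e : Fin n → Fin (suc (suc n))
    e t = punchIn x (punchIn (punchOut x≢y) t)

_[_]:=_ : ∀ {n} → (Fin n → Subset n) → Fin n → Subset n → Fin n → Subset n
g [ z ]:= T = updateAt g z (const T)

module _ {n} (g : Fin n → Subset n) (z : Fin n) (T : Subset n) where

  :=-at : (g [ z ]:= T) z ≡ T
  :=-at = updateAt-updates z g

  :=-elsewhere : ∀ {w} → w ≢ z → (g [ z ]:= T) w ≡ g w
  :=-elsewhere {w} w≢z = updateAt-minimal w z g w≢z

  :=-wins : (G : SimpleGame n) → (∀ w → win G (g w) ≡ true) → win G T ≡ true →
    ∀ w → win G ((g [ z ]:= T) w) ≡ true
  :=-wins G g-wins T-wins w with w ≟ z
  ... | yes refl = trans (cong (win G) :=-at) T-wins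
  ... | no  w≢z  = trans (cong (win G) (:=-elsewhere w≢z)) (g-wins w)

  :=-misses-at : ∀ {u} → T ∌ u → (g [ z ]:= T) z ∌ u
  :=-misses-at {u} T∌u = trans (cong (λ S → lookup S u) :=-at) T∌u

  :=-misses-elsewhere : ∀ {w u} → w ≢ z → g w ∌ u → (g [ z ]:= T) w ∌ u
  :=-misses-elsewhere {u = u} w≢z gw∌u = trans (cong (λ S → lookup S u) (:=-elsewhere w≢z)) gw∌u

-- The graph of edges

pair : ∀ {n} → Fin n → Fin n → Fin n → Bool
pair a b w = w == a ∨ w == b

triangle : ∀ {n} → Fin n → Fin n → Fin n → Fin n → Bool
triangle a b c w = w == a ∨ pair b c w

#-pair : ∀ {n} {a b : Fin n} → a ≢ b → # (pair a b) ≡ 2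
#-pair {a = a} {b} a≢b = trans (#-∨ _ _ disjoint) (cong₂ _+_ (#-singleton a) (#-singleton b))
  where
  disjoint : ∀ w → (w == a) ≡ true → (w == b) ≡ false
  disjoint w w==a with refl ← ==⇒≡ {x = w} {a} w==a = ==-≢ a≢b

#-triangle : ∀ {n} {a b c : Fin n} → Distinct₃ a b c → # (triangle a b c) ≡ 3
#-triangle {a = a} {b} {c} (a≢b , a≢c , b≢c) = trans (#-∨ _ _ disjoint) (cong₂ _+_ (#-singleton a) (#-pair b≢c))
  where
  disjoint : ∀ w → (w == a) ≡ true → pair b c w ≡ false
  disjoint w w==a with refl ← ==⇒≡ {x = w} {a} w==a rewrite ==-≢ a≢b | ==-≢ a≢c = refl

distinct₃⇒3≤n : ∀ {n} {a b c : Fin n} → Distinct₃ a b c → 3 ≤ n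
distinct₃⇒3≤n {n} {a} {b} {c} distinct = subst (_≤ n) (#-triangle distinct) (#≤n (triangle a b c))

pair-∋ : ∀ {n} {a b x : Fin n} → pair a b x ≡ true → x ≡ a ⊎ x ≡ b
pair-∋ {a = a} {b} {x} x∈ with x ≟ a | x ≟ b
... | yes x≡a | _       = inj₁ x≡a
... | no _    | yes x≡b = inj₂ x≡b

pair-∌ : ∀ {n} {a b x : Fin n} → pair a b x ≡ false → x ≢ a × x ≢ b
pair-∌ {a = a} {b} {x} x∉ with x ≟ a | x ≟ b
... | no x≢a | no x≢b = x≢a , x≢b

triangle-∋ : ∀ {n} {a b c x : Fin n} → triangle a b c x ≡ true → x ≡ a ⊎ x ≡ b ⊎ x ≡ c
triangle-∋ {a = a} {b} {c} {x} x∈ with x ≟ a | x ≟ b | x ≟ c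
... | yes x≡a | _       | _       = inj₁ x≡a
... | no _    | yes x≡b | _       = inj₂ (inj₁ x≡b)
... | no _    | no _    | yes x≡c = inj₂ (inj₂ x≡c)

triangle-∌ : ∀ {n} {a b c x : Fin n} → triangle a b c x ≡ false → x ≢ a × x ≢ b × x ≢ c
triangle-∌ {a = a} {b} {c} {x} x∉ with x ≟ a | x ≟ b | x ≟ c
... | no x≢a | no x≢b | no x≢c = x≢a , x≢b , x≢c

module _ {n} (G : SimpleGame n) where

  edge : Fin n → Fin n → Bool
  edge x y = win G (allBut₂ x y)

  edge-sym : ∀ {x y} → x ≢ y → edge x y ≡ edge y x
  edge-sym x≢y = cong (win G) (allBut₂-comm x≢y)

  Star : Fin n → Set
  Star a = ∀ {x y} → x ≢ y → x ≢ a → y ≢ a → edge x y ≡ false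

  Clique : (Fin n → Bool) → Set
  Clique P = ∀ {x y} → x ≢ y → edge x y ≡ (P x ∧ P y)

  data EdgeShape : Set where
    star-shaped     : ∀ {a b} → a ≢ b → edge a b ≡ true → Star a → EdgeShape
    triangle-shaped : ∀ {a b c} → Distinct₃ a b c → Clique (triangle a b c) → EdgeShape

module _ {n} (G : SimpleGame (suc (suc n))) (allBut-wins : ∀ x → win G (allBut x) ≡ true) where

  misses-three-loses : FamiliesAtLeast G (suc n) →
    ∀ {S x y z} → Distinct₃ x y z → S ∌ x → S ∌ y → S ∌ z → win G S ≡ false
  misses-three-loses atLeast {S} {x} {y} {z} (x≢y , x≢z , y≢z) S∌x S∌y S∌z with win G S in S-wins
  ... | false = refl
  ... | true  = ⊥-elim (1+n≰n (covering-avoiding₂ G atLeast g (:=-wins allBut z S G allBut-wins S-wins) x≢y covers))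
    where
    g = allBut [ z ]:= S
    by-S : ∀ {u} → S ∌ u → ∃ λ w → w ≢ x × w ≢ y × g w ∌ u
    by-S S∌u = z , x≢z ∘ sym , y≢z ∘ sym , :=-misses-at allBut z S S∌u
    covers : ∀ u → ∃ λ w → w ≢ x × w ≢ y × g w ∌ u
    covers u with u ≟ x | u ≟ y | u ≟ z
    ... | yes refl | _        | _        = by-S S∌x
    ... | no _     | yes refl | _        = by-S S∌y
    ... | no _     | no _     | yes refl = by-S S∌z
    ... | no u≢x   | no u≢y   | no u≢z   = u , u≢x , u≢y , :=-misses-elsewhere allBut z S u≢z (allBut∌ u)

  -- The two edges and N ∖ {u} for u ∉ {x, y, a, b} would be a family of n - 2 winning coalitions.
  no-disjoint-edges : FamiliesAtLeast G (suc n) → ∀ {x y a b} → x ≢ y → a ≢ b →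
    a ≢ x → a ≢ y → b ≢ x → b ≢ y → edge G x y ≡ true → edge G a b ≡ false
  no-disjoint-edges atLeast {x} {y} {a} {b} x≢y a≢b a≢x a≢y b≢x b≢y xy-wins with edge G a b in ab-wins
  ... | false = refl
  ... | true  = ⊥-elim (1+n≰n (covering-avoiding₂ G atLeast g g-wins x≢y covers))
    where
    g′ = allBut [ b ]:= allBut₂ a b
    g = g′ [ a ]:= allBut₂ x y
    g-wins = :=-wins g′ a (allBut₂ x y) G (:=-wins allBut b (allBut₂ a b) G allBut-wins ab-wins) xy-wins
    by-a : ∀ {u} → allBut₂ x y ∌ u → ∃ λ w → w ≢ x × w ≢ y × g w ∌ u
    by-a missed = a , a≢x , a≢y , :=-misses-at g′ a (allBut₂ x y) missed
    by-b : ∀ {u} → allBut₂ a b ∌ u → ∃ λ w → w ≢ x × w ≢ y × g w ∌ u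
    by-b missed =
      b , b≢x , b≢y , :=-misses-elsewhere g′ a (allBut₂ x y) (a≢b ∘ sym) (:=-misses-at allBut b (allBut₂ a b) missed)
    covers : ∀ u → ∃ λ w → w ≢ x × w ≢ y × g w ∌ u
    covers u with u ≟ x | u ≟ y | u ≟ a | u ≟ b
    ... | yes refl | _        | _        | _        = by-a (allBut₂∌ˡ x≢y)
    ... | no _     | yes refl | _        | _        = by-a (allBut₂∌ʳ x u)
    ... | no _     | no _     | yes refl | _        = by-b (allBut₂∌ˡ a≢b)
    ... | no _     | no _     | no _     | yes refl = by-b (allBut₂∌ʳ a u)
    ... | no u≢x   | no u≢y   | no u≢a   | no u≢b   =
      u , u≢x , u≢y ,
      :=-misses-elsewhere g′ a (allBut₂ x y) u≢a (:=-misses-elsewhere allBut b (allBut₂ a b) u≢b (allBut∌ u))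

  -- With ν = n even a single edge {a, b} is too many: it and N ∖ {u} (u ≠ a, b) are n - 1 coalitions.
  no-edge : FamiliesAtLeast G (suc (suc n)) → ∀ {a b} → a ≢ b → edge G a b ≡ false
  no-edge atLeast {a} {b} a≢b with edge G a b in ab-wins
  ... | false = refl
  ... | true  = ⊥-elim (1+n≰n (covering-avoiding₁ G atLeast g g-wins a covers))
    where
    g = allBut [ b ]:= allBut₂ a b
    g-wins = :=-wins allBut b (allBut₂ a b) G allBut-wins ab-wins
    covers : ∀ u → ∃ λ w → w ≢ a × g w ∌ u
    covers u with u ≟ a | u ≟ b
    ... | yes refl | _        = b , a≢b ∘ sym , :=-misses-at allBut b (allBut₂ a b) (allBut₂∌ˡ a≢b)
    ... | no _     | yes refl = b , a≢b ∘ sym , :=-misses-at allBut b (allBut₂ a b) (allBut₂∌ʳ a u)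
    ... | no u≢a   | no u≢b   = u , u≢a , :=-misses-elsewhere allBut b (allBut₂ a b) u≢b (allBut∌ u)

  module _ (atLeast : FamiliesAtLeast G (suc n)) where

    private
      other-neighbour : ∀ a b c → Dec (c ≢ a × c ≢ b × edge G a c ≡ true)
      other-neighbour a b c = ¬? (c ≟ a) ×-dec ¬? (c ≟ b) ×-dec (edge G a c Bool.≟ true)

      lonely : ∀ {a b} → ¬ (∃ λ c → c ≢ a × c ≢ b × edge G a c ≡ true) →
        ∀ d → d ≢ b → d ≢ a → edge G a d ≡ false
      lonely ∄c d d≢b d≢a = ¬-not λ ad → ∄c (d , d≢a , d≢b , ad)

    star-from : ∀ {a b} → a ≢ b → edge G a b ≡ true → (∀ d → d ≢ a → d ≢ b → edge G b d ≡ false) →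
      Star G a
    star-from {a} {b} a≢b ab-edge b-lonely {x} {y} x≢y x≢a y≢a with x ≟ b | y ≟ b
    ... | yes refl | _        = b-lonely y y≢a (x≢y ∘ sym)
    ... | no _     | yes refl = trans (edge-sym G x≢y) (b-lonely x x≢a x≢y)
    ... | no x≢b   | no y≢b   = no-disjoint-edges atLeast a≢b x≢y x≢a x≢b y≢a y≢b ab-edge

    module _ {a b c} (a≢b : a ≢ b) (a≢c : a ≢ c) (b≢c : b ≢ c)
             (ab : edge G a b ≡ true) (ac : edge G a c ≡ true) (bc : edge G b c ≡ true) where

      private
        inside : ∀ {x y} → x ≢ y → x ≡ a ⊎ x ≡ b ⊎ x ≡ c → y ≡ a ⊎ y ≡ b ⊎ y ≡ c →
          edge G x y ≡ true
        inside x≢y (inj₁ refl)        (inj₁ refl)        = ⊥-elim (x≢y refl)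
        inside x≢y (inj₁ refl)        (inj₂ (inj₁ refl)) = ab
        inside x≢y (inj₁ refl)        (inj₂ (inj₂ refl)) = ac
        inside x≢y (inj₂ (inj₁ refl)) (inj₁ refl)        = trans (edge-sym G x≢y) ab
        inside x≢y (inj₂ (inj₁ refl)) (inj₂ (inj₁ refl)) = ⊥-elim (x≢y refl)
        inside x≢y (inj₂ (inj₁ refl)) (inj₂ (inj₂ refl)) = bc
        inside x≢y (inj₂ (inj₂ refl)) (inj₁ refl)        = trans (edge-sym G x≢y) ac
        inside x≢y (inj₂ (inj₂ refl)) (inj₂ (inj₁ refl)) = trans (edge-sym G x≢y) bc
        inside x≢y (inj₂ (inj₂ refl)) (inj₂ (inj₂ refl)) = ⊥-elim (x≢y refl)

        outside : ∀ {x} → x ≢ a → x ≢ b → x ≢ c → ∀ {y} → x ≢ y → edge G x y ≡ false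
        outside {x} x≢a x≢b x≢c {y} x≢y with y ≟ a | y ≟ b
        ... | yes refl | _        = no-disjoint-edges atLeast b≢c x≢y x≢b x≢c a≢b a≢c bc
        ... | no y≢a   | yes refl = no-disjoint-edges atLeast a≢c x≢y x≢a x≢c y≢a b≢c ac
        ... | no y≢a   | no y≢b   = no-disjoint-edges atLeast a≢b x≢y x≢a x≢b y≢a y≢b ab

      triangle-clique : Clique G (triangle a b c)
      triangle-clique {x} {y} x≢y with triangle a b c x in x∈? | triangle a b c y in y∈?
      ... | false | _     = let x≢a , x≢b , x≢c = triangle-∌ x∈? in outside x≢a x≢b x≢c x≢y
      ... | true  | false = let y≢a , y≢b , y≢c = triangle-∌ y∈? in
                            trans (edge-sym G x≢y) (outside y≢a y≢b y≢c (x≢y ∘ sym))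
      ... | true  | true  = inside x≢y (triangle-∋ x∈?) (triangle-∋ y∈?)

    edgeShape : ∀ {a b} → a ≢ b → edge G a b ≡ true → EdgeShape G
    edgeShape {a} {b} a≢b ab with any? (other-neighbour a b) | any? (other-neighbour b a)
    ... | no ∄c | _     = star-shaped (a≢b ∘ sym) ba (star-from (a≢b ∘ sym) ba (lonely ∄c))
      where ba = trans (edge-sym G (a≢b ∘ sym)) ab
    ... | yes _ | no ∄d = star-shaped a≢b ab (star-from a≢b ab (lonely ∄d))
    ... | yes (c , c≢a , c≢b , ac) | yes (d , d≢b , d≢a , bd) with c ≟ d
    ...   | yes refl = triangle-shaped (a≢b , a≢c , b≢c) (triangle-clique a≢b a≢c b≢c ab ac bd)
      where
      a≢c = c≢a ∘ sym
      b≢c = c≢b ∘ sym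
    ...   | no c≢d   with () ← trans (sym bd)
                               (no-disjoint-edges atLeast (c≢a ∘ sym) (d≢b ∘ sym) (a≢b ∘ sym) (c≢b ∘ sym) d≢a (c≢d ∘ sym) ac)

pairDetermined : ∀ {n m} (G : SimpleGame (suc (suc n))) → HasFamily G m → FamiliesAtLeast G (suc n) → PairDetermined G
pairDetermined G family atLeast = record
  { allBut-wins        = family⇒allBut-wins G family
  ; misses-three-loses = misses-three-loses G (family⇒allBut-wins G family) atLeast
  }

-- The five games

value₂₁ : Fin 2 → ℕ
value₂₁ 0F = 2
value₂₁ 1F = 1

value₂₁-injective : ∀ u u′ → value₂₁ u ≡ value₂₁ u′ → u ≡ u′
value₂₁-injective 0F 0F _ = refl
value₂₁-injective 1F 1F _ = refl
value₂₁-injective 0F 1F ()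
value₂₁-injective 1F 0F ()

value₂₁-bounds : ∀ u → 1 ≤ value₂₁ u × value₂₁ u ≤ 2
value₂₁-bounds 0F = s≤s z≤n , ≤-refl
value₂₁-bounds 1F = ≤-refl , s≤s z≤n

value₁₀ : Fin 2 → ℕ
value₁₀ 0F = 1
value₁₀ 1F = 0

value₁₀-injective : ∀ u u′ → value₁₀ u ≡ value₁₀ u′ → u ≡ u′
value₁₀-injective 0F 0F _ = refl
value₁₀-injective 1F 1F _ = refl
value₁₀-injective 0F 1F ()
value₁₀-injective 1F 0F ()

value₁₀≤1 : ∀ u → value₁₀ u ≤ 1
value₁₀≤1 0F = ≤-refl
value₁₀≤1 1F = z≤n

clique-total : ∀ f s → 1 ≤ f → 2 * (f + s) ∸ (2 + s) + 2 ≡ 2 * f + (1 * s + 0)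
clique-total (suc g) s _ = begin
  2 * (suc g + s) ∸ (2 + s) + 2       ≡⟨ cong (λ m → m ∸ (2 + s) + 2) (expand g s) ⟩
  (2 + s) + (2 * g + s) ∸ (2 + s) + 2 ≡⟨ cong (_+ 2) (m+n∸m≡n (2 + s) (2 * g + s)) ⟩
  2 * g + s + 2                       ≡⟨ regroup g s ⟩
  2 * suc g + (1 * s + 0)             ∎
  where
  open ≡-Reasoning
  expand : ∀ g s → 2 * (suc g + s) ≡ (2 + s) + (2 * g + s)
  expand = solve-∀
  regroup : ∀ g s → 2 * g + s + 2 ≡ 2 * suc g + (1 * s + 0)
  regroup = solve-∀

-- The weights 1 on the clique P and 2 elsewhere, with threshold 2, make exactly the pairs inside P edges.
clique-game : ∀ {n} {G : SimpleGame n} → PairDetermined G → (P : Fin n → Bool) → ∀ s →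
  # P ≡ s → 2 ≤ s → s < n → Clique G P →
  IsoTo G (weighted (2 * n ∸ (2 + s)) (λ i → if toℕ i <ᵇ n ∸ s then 2 else 1)) × NumClasses G 2
clique-game {n} {G} pd P s #P≡s 2≤s s<n clique =
  recognise pd form (layer₂ (n ∸ s)) _ (λ i → sym (if-float value₂₁ (toℕ i <ᵇ n ∸ s))) same-fibres
  where
  #in : fibre (split P) 1F ≡ s
  #in = trans (fibre-split P) #P≡s
  #in+#out : fibre (split P) 0F + s ≡ n
  #in+#out = trans (cong (fibre (split P) 0F +_) (sym #in)) (fibre₂-sum (split P))
  1≤#out : 1 ≤ fibre (split P) 0F
  1≤#out = +-cancelʳ-≤ s 1 _ (subst (suc s ≤_) (sym #in+#out) s<n)

  total : 2 * n ∸ (2 + s) + 2 ≡ sum (value₂₁ ∘ split P)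
  total = begin
    2 * n ∸ (2 + s) + 2                         ≡⟨ cong (λ m → 2 * m ∸ (2 + s) + 2) #in+#out ⟨
    2 * (fibre (split P) 0F + s) ∸ (2 + s) + 2  ≡⟨ clique-total _ s 1≤#out ⟩
    2 * fibre (split P) 0F + (1 * s + 0)        ≡⟨ cong (λ m → 2 * fibre (split P) 0F + (1 * m + 0)) #in ⟨
    sum (λ u → value₂₁ u * fibre (split P) u)   ≡⟨ sum-by-fibre value₂₁ (split P) ⟨
    sum (value₂₁ ∘ split P)                     ∎
    where open ≡-Reasoning

  pair-table : ∀ a b → (a ∧ b) ≡ (value₂₁ (if a then 1F else 0F) + value₂₁ (if b then 1F else 0F) ≤ᵇ 2)
  pair-table true  true  = refl
  pair-table true  false = refl
  pair-table false true  = refl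
  pair-table false false = refl

  value-inside : ∀ {z} → P z ≡ true → value₂₁ (split P z) ≡ 1
  value-inside Pz = cong (λ b → value₂₁ (if b then 1F else 0F)) Pz

  separated : Separated (value₂₁ ∘ split P) 2
  separated i j vi<vj with P i in Pi | P j in Pj
  ... | true  | true  = ⊥-elim (<-irrefl refl vi<vj)
  ... | false | true  = ⊥-elim (<⇒≱ vi<vj (s≤s z≤n))
  ... | false | false = ⊥-elim (<-irrefl refl vi<vj)
  ... | true  | false
    with z , Pz , z≢i ← 2≤#⇒∃-other P i (subst (2 ≤_) (sym #P≡s) 2≤s) =
    z , z≢i , (λ { refl → contradiction (trans (sym Pz) Pj) λ () }) ,
    subst (λ m → 1 + m ≤ 2) (sym (value-inside Pz)) ≤-refl , subst (λ m → 2 < 2 + m) (sym (value-inside Pz)) ≤-refl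

  form : WeightedForm G 2
  form = record
    { class           = split P
    ; value           = value₂₁
    ; value-injective = value₂₁-injective
    ; class-onto      = λ where
        0F → fibre-onto (split P) 1≤#out
        1F → fibre-onto (split P) (subst (1 ≤_) (sym #in) (≤-trans (s≤s z≤n) 2≤s))
    ; quota           = 2 * n ∸ (2 + s)
    ; threshold       = 2
    ; total           = total
    ; pairs           = record
      { below-threshold = λ x → proj₂ (value₂₁-bounds (split P x))
      ; pair-wins       = λ {x} {y} x≢y → trans (clique x≢y) (pair-table (P x) (P y))
      ; triple-exceeds  = λ {x} {y} {z} _ → +-mono-≤ (+-mono-≤ (proj₁ (value₂₁-bounds (split P x)))
                                                               (proj₁ (value₂₁-bounds (split P y))))
                                                     (proj₁ (value₂₁-bounds (split P z)))
      }
    ; separated       = separated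
    }

  same-fibres : ∀ u → fibre (split P) u ≡ fibre (layer₂ {n} (n ∸ s)) u
  same-fibres = fibres-agree₂ (split P) (layer₂ (n ∸ s)) (trans #in (sym (trans (fibre-layer₂ (n ∸ s) (m∸n≤m n s))
                                                          (m∸[m∸n]≡n (<⇒≤ s<n)))))

value₅₃₁ : Fin 3 → ℕ
value₅₃₁ 0F = 5
value₅₃₁ 1F = 3
value₅₃₁ 2F = 1

value₅₃₁-injective : ∀ u u′ → value₅₃₁ u ≡ value₅₃₁ u′ → u ≡ u′
value₅₃₁-injective 0F 0F _ = refl
value₅₃₁-injective 1F 1F _ = refl
value₅₃₁-injective 2F 2F _ = refl
value₅₃₁-injective 0F 1F ()
value₅₃₁-injective 0F 2F ()
value₅₃₁-injective 1F 0F ()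
value₅₃₁-injective 1F 2F ()
value₅₃₁-injective 2F 0F ()
value₅₃₁-injective 2F 1F ()

value₅₃₁-bounds : ∀ u → 1 ≤ value₅₃₁ u × value₅₃₁ u ≤ 5
value₅₃₁-bounds 0F = s≤s z≤n , ≤-refl
value₅₃₁-bounds 1F = s≤s z≤n , s≤s (s≤s (s≤s z≤n))
value₅₃₁-bounds 2F = ≤-refl , s≤s z≤n

module _ {o k : ℕ} (1≤o : 1 ≤ o) where

  star-4≤ : 2 ≤ k → 4 ≤ o + (k + 1)
  star-4≤ 2≤k = +-mono-≤ 1≤o (+-monoˡ-≤ 1 2≤k)

  star-k≤ : k ≤ o + (k + 1) ∸ 2
  star-k≤ = m+n≤o⇒m≤o∸n k (≤-trans (≤-reflexive (+-suc k 1)) (+-monoˡ-≤ (k + 1) 1≤o))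

  star-others : o + (k + 1) ∸ k ∸ 1 ≡ o
  star-others = trans (∸-+-assoc (o + (k + 1)) k 1) (m+n∸n≡m o (k + 1))

star-total : ∀ o k → 1 ≤ o → 5 * (o + (k + 1)) ∸ 2 * k ∸ 9 + 5 ≡ 5 * o + (3 * k + (1 * 1 + 0))
star-total (suc g) k _ = begin
  5 * (suc g + (k + 1)) ∸ 2 * k ∸ 9 + 5             ≡⟨ cong (λ m → m ∸ 2 * k ∸ 9 + 5) (expand g k) ⟩
  2 * k + (9 + (5 * g + 3 * k + 1)) ∸ 2 * k ∸ 9 + 5 ≡⟨ cong (λ m → m ∸ 9 + 5) (m+n∸m≡n (2 * k) _) ⟩
  9 + (5 * g + 3 * k + 1) ∸ 9 + 5                   ≡⟨ cong (_+ 5) (m+n∸m≡n 9 _) ⟩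
  5 * g + 3 * k + 1 + 5                             ≡⟨ regroup g k ⟩
  5 * suc g + (3 * k + (1 * 1 + 0))                 ∎
  where
  open ≡-Reasoning
  expand : ∀ g k → 5 * (suc g + (k + 1)) ≡ 2 * k + (9 + (5 * g + 3 * k + 1))
  expand = solve-∀
  regroup : ∀ g k → 5 * g + 3 * k + 1 + 5 ≡ 5 * suc g + (3 * k + (1 * 1 + 0))
  regroup = solve-∀

module _ {n} (G : SimpleGame n) (a : Fin n) where

  kind : Fin n → Fin 3
  kind w with w ≟ a | edge G a w
  ... | yes _ | _     = 2F
  ... | no _  | true  = 1F
  ... | no _  | false = 0F

  leaves : ℕ
  leaves = fibre kind 1F

  kind-centre : kind a ≡ 2F
  kind-centre with a ≟ a
  ... | yes _   = refl
  ... | no a≢a  = ⊥-elim (a≢a refl)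

  kind-leaf : ∀ {w} → w ≢ a → edge G a w ≡ true → kind w ≡ 1F
  kind-leaf {w} w≢a aw with w ≟ a
  ... | yes w≡a = ⊥-elim (w≢a w≡a)
  ... | no _ rewrite aw = refl

  kind-other : ∀ {w} → w ≢ a → edge G a w ≡ false → kind w ≡ 0F
  kind-other {w} w≢a aw with w ≟ a
  ... | yes w≡a = ⊥-elim (w≢a w≡a)
  ... | no _ rewrite aw = refl

  is-centre : ∀ w → (kind w == 2F) ≡ does (w ≟ a)
  is-centre w with w ≟ a | edge G a w
  ... | yes _ | _     = refl
  ... | no _  | true  = refl
  ... | no _  | false = refl

  fibre-kind-2F : fibre kind 2F ≡ 1
  fibre-kind-2F = trans (#-cong is-centre) (#-singleton a)

  others+leaves+1 : fibre kind 0F + (leaves + 1) ≡ n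
  others+leaves+1 = trans (cong (λ m → fibre kind 0F + (leaves + m)) (sym (trans (+-identityʳ _) fibre-kind-2F)))
                          (sum-fibre kind)

≢-by-kind : ∀ {n} (G : SimpleGame n) a {x y u u′} → kind G a x ≡ u → kind G a y ≡ u′ → u ≢ u′ → x ≢ y
≢-by-kind G a kx ky u≢u′ refl = u≢u′ (trans (sym kx) ky)

two-off-centre : ∀ {n} {x y z : Fin n} → Distinct₃ x y z → ∀ a →
  (x ≢ a × y ≢ a) ⊎ (x ≢ a × z ≢ a) ⊎ (y ≢ a × z ≢ a)
two-off-centre {x = x} {y} {z} (x≢y , x≢z , y≢z) a with x ≟ a | y ≟ a
... | yes refl | _        = inj₂ (inj₂ (x≢y ∘ sym , x≢z ∘ sym))
... | no x≢a   | yes refl = inj₂ (inj₁ (x≢a , y≢z ∘ sym))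
... | no x≢a   | no y≢a   = inj₁ (x≢a , y≢a)

edge⇒3≤n : ∀ {n} (G : SimpleGame n) {a b} → a ≢ b → edge G a b ≡ true → 3 ≤ n
edge⇒3≤n G {a} {b} a≢b ab with z , z∈ ← winning-nonempty G ab =
  distinct₃⇒3≤n (a≢b , ∌⇒≢ (allBut₂ a b) (allBut₂∌ˡ a≢b) z∈ ∘ sym , ∌⇒≢ (allBut₂ a b) (allBut₂∌ʳ a b) z∈ ∘ sym)

ν≡n∸1-Game : ∀ n → SimpleGame n → Set
ν≡n∸1-Game n G =
  (3 ≤ n × IsoTo G (weighted (2 * n ∸ 4) (w1 n)) × NumClasses G 2)
  ⊎ (n ≡ 3 × IsoTo G (weighted 1 (λ _ → 1)) × NumClasses G 1)
  ⊎ (4 ≤ n × IsoTo G (weighted (2 * n ∸ 5) (w3 n)) × NumClasses G 2)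
  ⊎ (3 ≤ n × IsoTo G (weighted (n ∸ 2) (w4 n)) × NumClasses G 2)
  ⊎ (∃ λ (k : ℕ) → 4 ≤ n × 2 ≤ k × k ≤ n ∸ 2 ×
       IsoTo G (weighted (5 * n ∸ 2 * k ∸ 9) (w5 n k)) × NumClasses G 3)

module _ {n} {G : SimpleGame (suc (suc n))} (pd : PairDetermined G)
         {a b} (a≢b : a ≢ b) (ab : edge G a b ≡ true) (star : Star G a) where

  private
    N = suc (suc n)
    3≤N = edge⇒3≤n G a≢b ab

    leaf-b : kind G a b ≡ 1F
    leaf-b = kind-leaf G a (a≢b ∘ sym) ab

    is-leaf : ∀ {w} → kind G a w ≡ 1F → (kind G a w == 1F) ≡ true
    is-leaf kw = trans (cong (_== 1F) kw) (==-refl {3} 1F)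

  star-one-leaf : leaves G a ≡ 1 → 3 ≤ N × IsoTo G (weighted (2 * N ∸ 4) (w1 N)) × NumClasses G 2
  star-one-leaf one = 3≤N , clique-game pd (pair a b) 2 (#-pair a≢b) ≤-refl 3≤N clique
    where
    only-leaf : ∀ {y} → y ≢ a → y ≢ b → edge G a y ≡ false
    only-leaf {y} y≢a y≢b with edge G a y in ay
    ... | false = refl
    ... | true  = ⊥-elim (1+n≰n (subst (2 ≤_) one
                    (2≤# _ y≢b (is-leaf (kind-leaf G a y≢a ay)) (is-leaf leaf-b))))
    outside : ∀ {x y} → x ≢ a → x ≢ b → x ≢ y → edge G x y ≡ false
    outside {x} {y} x≢a x≢b x≢y with y ≟ a
    ... | yes refl = trans (edge-sym G x≢y) (only-leaf x≢a x≢b)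
    ... | no y≢a   = star x≢y x≢a y≢a
    inside : ∀ {x y} → x ≢ y → x ≡ a ⊎ x ≡ b → y ≡ a ⊎ y ≡ b → edge G x y ≡ true
    inside x≢y (inj₁ refl) (inj₁ refl) = ⊥-elim (x≢y refl)
    inside x≢y (inj₁ refl) (inj₂ refl) = ab
    inside x≢y (inj₂ refl) (inj₁ refl) = trans (edge-sym G x≢y) ab
    inside x≢y (inj₂ refl) (inj₂ refl) = ⊥-elim (x≢y refl)
    clique : Clique G (pair a b)
    clique {x} {y} x≢y with pair a b x in x∈? | pair a b y in y∈?
    ... | false | _     = let x≢a , x≢b = pair-∌ x∈? in outside x≢a x≢b x≢y
    ... | true  | false = let y≢a , y≢b = pair-∌ y∈? in trans (edge-sym G x≢y) (outside y≢a y≢b (x≢y ∘ sym))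
    ... | true  | true  = inside x≢y (pair-∋ x∈?) (pair-∋ y∈?)

  star-all-leaves : leaves G a ≡ suc n → 3 ≤ N × IsoTo G (weighted (N ∸ 2) (w4 N)) × NumClasses G 2
  star-all-leaves all = 3≤N , recognise pd form (layer₂ (N ∸ 1)) (w4 N)
    (λ i → sym (if-float value₁₀ (toℕ i <ᵇ N ∸ 1))) same-fibres
    where
    no-others : fibre (kind G a) 0F ≡ 0
    no-others = +-cancelʳ-≡ (leaves G a + 1) _ 0
      (trans (others+leaves+1 G a) (sym (trans (cong (_+ 1) all) (+-comm (suc n) 1))))
    all-leaf : ∀ {y} → y ≢ a → edge G a y ≡ true
    all-leaf {y} y≢a with edge G a y in ay
    ... | true  = refl
    ... | false = ⊥-elim (1+n≰n (subst (1 ≤_) no-others (∃⇒1≤# (λ w → kind G a w == 0F) {y} y-other)))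
      where y-other = trans (cong (_== 0F) (kind-other G a y≢a ay)) (==-refl {3} 0F)

    #centre : fibre (split (_== a)) 1F ≡ 1
    #centre = trans (fibre-split (_== a)) (#-singleton a)

    same-fibres : ∀ u → fibre (split (_== a)) u ≡ fibre (layer₂ {N} (N ∸ 1)) u
    same-fibres = fibres-agree₂ (split (_== a)) (layer₂ (N ∸ 1))
      (trans #centre (sym (trans (fibre-layer₂ (N ∸ 1) (m∸n≤m N 1)) (m∸[m∸n]≡n {N} (s≤s z≤n)))))

    v : Fin N → ℕ
    v = value₁₀ ∘ split (_== a)

    total : N ∸ 2 + 1 ≡ sum v
    total = begin
      n + 1                                               ≡⟨ +-comm n 1 ⟩
      suc n                                               ≡⟨ +-cancelʳ-≡ 1 _ _ (trans #non-centres (+-comm 1 (suc n))) ⟨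
      fibre (split (_== a)) 0F                            ≡⟨ rearrange _ ⟩
      1 * fibre (split (_== a)) 0F + (0 * 1 + 0)          ≡⟨ cong (λ m → 1 * fibre (split (_== a)) 0F + (0 * m + 0)) #centre ⟨
      sum (λ u → value₁₀ u * fibre (split (_== a)) u)     ≡⟨ sum-by-fibre value₁₀ (split (_== a)) ⟨
      sum v                                               ∎
      where
      open ≡-Reasoning
      #non-centres : fibre (split (_== a)) 0F + 1 ≡ N
      #non-centres = trans (cong (fibre (split (_== a)) 0F +_) (sym #centre)) (fibre₂-sum (split (_== a)))
      rearrange : ∀ m → m ≡ 1 * m + (0 * 1 + 0)
      rearrange = solve-∀

    pair-wins : ∀ {x y} → x ≢ y → edge G x y ≡ (v x + v y ≤ᵇ 1)
    pair-wins {x} {y} x≢y with x ≟ a | y ≟ a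
    ... | yes refl | yes refl = ⊥-elim (x≢y refl)
    ... | yes refl | no y≢a   = all-leaf y≢a
    ... | no x≢a   | yes refl = trans (edge-sym G x≢y) (all-leaf x≢a)
    ... | no x≢a   | no y≢a   = star x≢y x≢a y≢a

    -- At most one of three distinct players is the centre, and the others weigh 1.
    triple-exceeds : ∀ {x y z} → Distinct₃ x y z → 1 < v x + v y + v z
    triple-exceeds {x} {y} {z} (x≢y , x≢z , y≢z) with x ≟ a | y ≟ a | z ≟ a
    ... | yes refl | yes refl | _        = ⊥-elim (x≢y refl)
    ... | yes refl | no _     | yes refl = ⊥-elim (x≢z refl)
    ... | no _     | yes refl | yes refl = ⊥-elim (y≢z refl)
    ... | yes _    | no _     | no _     = s≤s (s≤s z≤n)
    ... | no _     | yes _    | no _     = s≤s (s≤s z≤n)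
    ... | no _     | no _     | yes _    = s≤s (s≤s z≤n)
    ... | no _     | no _     | no _     = s≤s (s≤s z≤n)

    v-centre : v a ≡ 0
    v-centre = cong (λ c → value₁₀ (if c then 1F else 0F)) (==-refl a)

    v-leaf : ∀ {y} → y ≢ a → v y ≡ 1
    v-leaf y≢a = cong (λ c → value₁₀ (if c then 1F else 0F)) (==-≢ y≢a)

    separated : Separated v 1
    separated i j vi<vj = separate (i ≟ a) (j ≟ a)
      where
      separate : Dec (i ≡ a) → Dec (j ≡ a) → ∃ λ z → z ≢ i × z ≢ j × v i + v z ≤ 1 × 1 < v j + v z
      separate (no i≢a)   _          = ⊥-elim (<⇒≱ vi<vj (subst (v j ≤_) (sym (v-leaf i≢a)) (value₁₀≤1 _)))
      separate (yes i≡a) (yes j≡a)  = ⊥-elim (<-irrefl (cong v (trans i≡a (sym j≡a))) vi<vj)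
      separate (yes i≡a) (no j≢a)   =
        let z , z≢a , z≢j = third-player 3≤N a j
            vi≡0 = trans (cong v i≡a) v-centre
        in z , (λ z≡i → z≢a (trans z≡i i≡a)) , z≢j ,
           subst₂ (λ p q → p + q ≤ 1) (sym vi≡0) (sym (v-leaf z≢a)) ≤-refl ,
           subst₂ (λ p q → 1 < p + q) (sym (v-leaf j≢a)) (sym (v-leaf z≢a)) ≤-refl

    form : WeightedForm G 2
    form = record
      { class           = split (_== a)
      ; value           = value₁₀
      ; value-injective = value₁₀-injective
      ; class-onto      = λ where
          0F → b , cong (λ c → if c then 1F else 0F) (==-≢ (a≢b ∘ sym))
          1F → a , cong (λ c → if c then 1F else 0F) (==-refl a)
      ; quota           = N ∸ 2
      ; threshold       = 1
      ; total           = total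
      ; pairs           = record
        { below-threshold = value₁₀≤1 ∘ split (_== a)
        ; pair-wins       = pair-wins
        ; triple-exceeds  = triple-exceeds
        }
      ; separated       = separated
      }

  star-general : leaves G a ≢ 1 → leaves G a ≢ suc n →
    ∃ λ k → 4 ≤ N × 2 ≤ k × k ≤ N ∸ 2 × IsoTo G (weighted (5 * N ∸ 2 * k ∸ 9) (w5 N k)) × NumClasses G 3
  star-general k≢1 k≢1+n =
    k , subst (4 ≤_) o+k+1 (star-4≤ 1≤o 2≤k) , 2≤k , subst (λ m → k ≤ m ∸ 2) o+k+1 (star-k≤ 1≤o) ,
    recognise pd form (layer₃ p r) (w5 N k) w5≗layer same-fibres
    where
    k = leaves G a
    o = fibre (kind G a) 0F
    p = N ∸ k ∸ 1
    r = N ∸ 1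

    o+k+1 : o + (k + 1) ≡ N
    o+k+1 = others+leaves+1 G a

    2≤k : 2 ≤ k
    2≤k = ≤∧≢⇒< (∃⇒1≤# (λ w → kind G a w == 1F) {b} (is-leaf leaf-b)) (k≢1 ∘ sym)

    1≤o : 1 ≤ o
    1≤o = n≢0⇒n>0 λ o≡0 → k≢1+n (+-cancelʳ-≡ 1 k (suc n)
            (trans (sym (cong (_+ (k + 1)) o≡0)) (trans o+k+1 (+-comm 1 (suc n)))))

    v : Fin N → ℕ
    v = value₅₃₁ ∘ kind G a

    total : 5 * N ∸ 2 * k ∸ 9 + 5 ≡ sum v
    total = begin
      5 * N ∸ 2 * k ∸ 9 + 5                       ≡⟨ cong (λ m → 5 * m ∸ 2 * k ∸ 9 + 5) o+k+1 ⟨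
      5 * (o + (k + 1)) ∸ 2 * k ∸ 9 + 5           ≡⟨ star-total o k 1≤o ⟩
      5 * o + (3 * k + (1 * 1 + 0))               ≡⟨ cong (λ m → 5 * o + (3 * k + (1 * m + 0))) (fibre-kind-2F G a) ⟨
      sum (λ u → value₅₃₁ u * fibre (kind G a) u) ≡⟨ sum-by-fibre value₅₃₁ (kind G a) ⟨
      sum v                                       ∎
      where open ≡-Reasoning

    v-centre : v a ≡ 1
    v-centre = cong value₅₃₁ (kind-centre G a)

    v-off-centre : ∀ {y} → y ≢ a → v y ≡ (if edge G a y then 3 else 5)
    v-off-centre {y} y≢a = by-edge (edge G a y) refl
      where
      by-edge : ∀ c → edge G a y ≡ c → v y ≡ (if c then 3 else 5)
      by-edge true  ay = cong value₅₃₁ (kind-leaf G a y≢a ay)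
      by-edge false ay = cong value₅₃₁ (kind-other G a y≢a ay)

    1≤v : ∀ w → 1 ≤ v w
    1≤v w = proj₁ (value₅₃₁-bounds (kind G a w))

    3≤v : ∀ {y} → y ≢ a → 3 ≤ v y
    3≤v {y} y≢a = subst (3 ≤_) (sym (v-off-centre y≢a)) (at-least-3 (edge G a y))
      where
      at-least-3 : ∀ c → 3 ≤ (if c then 3 else 5)
      at-least-3 true  = ≤-refl
      at-least-3 false = s≤s (s≤s (s≤s z≤n))

    centre-pair : ∀ {y} → y ≢ a → edge G a y ≡ (v a + v y ≤ᵇ 5)
    centre-pair {y} y≢a =
      trans (table (edge G a y)) (cong₂ (λ p q → p + q ≤ᵇ 5) (sym v-centre) (sym (v-off-centre y≢a)))
      where
      table : ∀ c → c ≡ (1 + (if c then 3 else 5) ≤ᵇ 5)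
      table true  = refl
      table false = refl

    pair-wins : ∀ {x y} → x ≢ y → edge G x y ≡ (v x + v y ≤ᵇ 5)
    pair-wins {x} {y} x≢y = by-centre (x ≟ a) (y ≟ a)
      where
      by-centre : Dec (x ≡ a) → Dec (y ≡ a) → edge G x y ≡ (v x + v y ≤ᵇ 5)
      by-centre (yes x≡a) (yes y≡a) = ⊥-elim (x≢y (trans x≡a (sym y≡a)))
      by-centre (yes x≡a) (no y≢a)  = subst (λ x → edge G x y ≡ (v x + v y ≤ᵇ 5)) (sym x≡a) (centre-pair y≢a)
      by-centre (no x≢a)  (yes y≡a) = subst (λ y → edge G x y ≡ (v x + v y ≤ᵇ 5)) (sym y≡a)
        (trans (edge-sym G (x≢a)) (trans (centre-pair x≢a) (cong (_≤ᵇ 5) (+-comm (v a) (v x)))))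
      by-centre (no x≢a)  (no y≢a)  =
        trans (star x≢y x≢a y≢a) (sym (≤ᵇ-false (<⇒≱ (+-mono-≤ (3≤v x≢a) (3≤v y≢a)))))

    -- At most one of three distinct players is the centre (weight 1); the others weigh at least 3.
    triple-exceeds : ∀ {x y z} → Distinct₃ x y z → 5 < v x + v y + v z
    triple-exceeds {x} {y} {z} distinct with two-off-centre distinct a
    ... | inj₁ (x≢a , y≢a)        = ≤-trans (n≤1+n 6) (+-mono-≤ (+-mono-≤ (3≤v x≢a) (3≤v y≢a)) (1≤v z))
    ... | inj₂ (inj₁ (x≢a , z≢a)) = ≤-trans (n≤1+n 6) (+-mono-≤ (+-mono-≤ (3≤v x≢a) (1≤v y)) (3≤v z≢a))
    ... | inj₂ (inj₂ (y≢a , z≢a)) = ≤-trans (n≤1+n 6) (+-mono-≤ (+-mono-≤ (1≤v x) (3≤v y≢a)) (3≤v z≢a))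

    module _ {x y u u′} (kx : kind G a x ≡ u) (ky : kind G a y ≡ u′) where

      values : v x + v y ≡ value₅₃₁ u + value₅₃₁ u′
      values = cong₂ _+_ (cong value₅₃₁ kx) (cong value₅₃₁ ky)

      fits : (value₅₃₁ u + value₅₃₁ u′ ≤ᵇ 5) ≡ true → v x + v y ≤ 5
      fits e = subst (_≤ 5) (sym values) (≤ᵇ-sound e)

      exceeds : (6 ≤ᵇ value₅₃₁ u + value₅₃₁ u′) ≡ true → 5 < v x + v y
      exceeds e = subst (5 <_) (sym values) (≤ᵇ-sound e)

    -- The separating player z is another leaf, the leaf b, or the centre.
    separated : Separated v 5
    separated i j vi<vj = separate (kind G a i) (kind G a j) refl refl
      where
      Witness = ∃ λ z → z ≢ i × z ≢ j × v i + v z ≤ 5 × 5 < v j + v z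
      heavier : ∀ {u u′} → kind G a i ≡ u → kind G a j ≡ u′ → (value₅₃₁ u′ ≤ᵇ value₅₃₁ u) ≡ true →
        Witness
      heavier ki kj vj≤vi = ⊥-elim (<⇒≱ vi<vj
        (subst₂ _≤_ (cong value₅₃₁ (sym kj)) (cong value₅₃₁ (sym ki)) (≤ᵇ-sound vj≤vi)))
      separate : ∀ u u′ → kind G a i ≡ u → kind G a j ≡ u′ → Witness
      separate 2F 1F ki kj =
        let z , z-leaf , z≢j = 2≤#⇒∃-other (λ w → kind G a w == 1F) j 2≤k
            kz = ==⇒≡ {x = kind G a z} z-leaf
        in z , ≢-by-kind G a kz ki (λ ()) , z≢j , fits ki kz refl , exceeds kj kz refl
      separate 2F 0F ki kj =
        b , ≢-by-kind G a leaf-b ki (λ ()) , ≢-by-kind G a leaf-b kj (λ ()) , fits ki leaf-b refl , exceeds kj leaf-b refl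
      separate 1F 0F ki kj =
        a , ≢-by-kind G a (kind-centre G a) ki (λ ()) , ≢-by-kind G a (kind-centre G a) kj (λ ()) ,
        fits ki (kind-centre G a) refl , exceeds kj (kind-centre G a) refl
      separate 0F u′ ki kj = heavier ki kj (≤ᵇ-true (proj₂ (value₅₃₁-bounds u′)))
      separate 1F 1F ki kj = heavier ki kj refl
      separate 1F 2F ki kj = heavier ki kj refl
      separate 2F 2F ki kj = heavier ki kj refl

    form : WeightedForm G 3
    form = record
      { class           = kind G a
      ; value           = value₅₃₁
      ; value-injective = value₅₃₁-injective
      ; class-onto      = λ where
          0F → fibre-onto (kind G a) 1≤o
          1F → b , leaf-b
          2F → a , kind-centre G a
      ; quota           = 5 * N ∸ 2 * k ∸ 9
      ; threshold       = 5
      ; total           = total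
      ; pairs           = record
        { below-threshold = proj₂ ∘ value₅₃₁-bounds ∘ kind G a
        ; pair-wins       = pair-wins
        ; triple-exceeds  = triple-exceeds
        }
      ; separated       = separated
      }

    w5≗layer : ∀ i → w5 N k i ≡ value₅₃₁ (layer₃ p r i)
    w5≗layer i = sym (trans (if-float value₅₃₁ (toℕ i <ᵇ p))
                            (cong (λ m → if toℕ i <ᵇ p then 5 else m) (if-float value₅₃₁ (toℕ i <ᵇ r))))

    same-fibres : ∀ u → fibre (kind G a) u ≡ fibre (layer₃ {N} p r) u
    same-fibres = fibres-agree₃ (kind G a) (layer₃ p r)
      (trans (sym (subst (λ m → m ∸ k ∸ 1 ≡ o) o+k+1 (star-others {k = k} 1≤o)))
             (sym (fibre-layer₃-0F p r (≤-trans p≤r (m∸n≤m N 1)))))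
      (trans (fibre-kind-2F G a) (sym (trans (fibre-layer₃-2F p r p≤r (m∸n≤m N 1)) (m∸[m∸n]≡n {N} (s≤s z≤n)))))
      where
      p≤r : p ≤ r
      p≤r = ∸-monoˡ-≤ 1 (m∸n≤m N k)

  star-game : ν≡n∸1-Game N G
  star-game with leaves G a ℕ.≟ 1 | leaves G a ℕ.≟ suc n
  ... | yes one | _        = inj₁ (star-one-leaf one)
  ... | no k≢1  | yes all  = inj₂ (inj₂ (inj₂ (inj₁ (star-all-leaves all))))
  ... | no k≢1  | no k≢1+n = inj₂ (inj₂ (inj₂ (inj₂ (star-general k≢1 k≢1+n))))

-- With three players every pair is an edge, so all weights are equal.
triangle-game : ∀ {n} {G : SimpleGame (suc (suc n))} → PairDetermined G → ∀ {a b c} → Distinct₃ a b c →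
  Clique G (triangle a b c) → ν≡n∸1-Game (suc (suc n)) G
triangle-game {n} {G} pd {a} {b} {c} distinct clique with suc (suc n) ℕ.≟ 3
... | no N≢3 =
  inj₂ (inj₂ (inj₁ (4≤N , clique-game pd (triangle a b c) 3 (#-triangle distinct) (s≤s (s≤s z≤n)) 4≤N clique)))
  where
  4≤N : 4 ≤ suc (suc n)
  4≤N = ≤∧≢⇒< (distinct₃⇒3≤n distinct) (N≢3 ∘ sym)
... | yes refl = inj₂ (inj₁ (refl , recognise pd form (λ _ → 0F) (λ _ → 1) (λ _ → refl) (λ _ → refl)))
  where
  all-in : ∀ x → triangle a b c x ≡ true
  all-in = #≡n⇒all (triangle a b c) (#-triangle distinct)
  form : WeightedForm G 1
  form = record
    { class           = λ _ → 0F
    ; value           = λ _ → 1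
    ; value-injective = λ { 0F 0F _ → refl }
    ; class-onto      = λ { 0F → a , refl }
    ; quota           = 1
    ; threshold       = 2
    ; total           = refl
    ; pairs           = record
      { below-threshold = λ _ → s≤s z≤n
      ; pair-wins       = λ {x} {y} x≢y → trans (clique x≢y) (cong₂ _∧_ (all-in x) (all-in y))
      ; triple-exceeds  = λ _ → ≤-refl
      }
    ; separated       = λ i j 1<1 → ⊥-elim (<-irrefl refl 1<1)
    }

-- With ν = n there are no edges at all, so a coalition wins iff it misses at most one player.
majority-game : ∀ {n} (G : SimpleGame (suc (suc n))) → NuEq G (suc (suc n)) → IsoTo G (weighted (suc n) (λ _ → 1))
majority-game {n} G (family , atLeast) =
  isoTo-weighted {G = G} Perm.id (λ _ → refl) (weighted-by-threshold (suc n) pd threshold total)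
  where
  pd = pairDetermined G family (λ L e → ≤-trans (n≤1+n _) (atLeast L e))
  threshold : PairThreshold G (λ _ → 1) 1
  threshold = record
    { below-threshold = λ _ → ≤-refl
    ; pair-wins       = no-edge G (family⇒allBut-wins G family) atLeast
    ; triple-exceeds  = λ _ → s≤s (s≤s z≤n)
    }
  total : suc n + 1 ≡ sum {suc (suc n)} (λ _ → 1)
  total = trans (+-comm (suc n) 1) (sym (trans (sum-const (suc (suc n)) 1) (*-identityʳ (suc (suc n)))))

no-game : SimpleGame 0 → ⊥
no-game G = contradiction (trans (sym (empty-los G)) (full-win G)) λ ()

no-empty-family : ∀ {n} (G : SimpleGame (suc n)) → ¬ HasFamily G 0
no-empty-family G ([] , _ , _ , no-common) with () ← no-common fzero

no-singleton-family : (G : SimpleGame 1) → ¬ HasFamily G 1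
no-singleton-family G ((S ∷ []) , _ , (S-wins ∷ []) , no-common)
  with fzero , S∋0 ← winning-nonempty G S-wins | here S∌0 ← no-common fzero
  with () ← trans (sym S∋0) S∌0

lemma8 : ∀ (n : ℕ) (G : SimpleGame n) →
    (NuEq G n → 2 ≤ n × IsoTo G (weighted (n ∸ 1) (λ _ → 1))) ×
    (NuEq G (n ∸ 1) →
      (3 ≤ n × IsoTo G (weighted (2 * n ∸ 4) (w1 n)) × NumClasses G 2)
      ⊎ (n ≡ 3 × IsoTo G (weighted 1 (λ _ → 1)) × NumClasses G 1)
      ⊎ (4 ≤ n × IsoTo G (weighted (2 * n ∸ 5) (w3 n)) × NumClasses G 2)
      ⊎ (3 ≤ n × IsoTo G (weighted (n ∸ 2) (w4 n)) × NumClasses G 2)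
      ⊎ (∃ λ (k : ℕ) → 4 ≤ n × 2 ≤ k × k ≤ n ∸ 2 ×
           IsoTo G (weighted (5 * n ∸ 2 * k ∸ 9) (w5 n k)) × NumClasses G 3))
lemma8 zero          G = ⊥-elim (no-game G)
lemma8 (suc zero)    G = (λ ν≡1 → ⊥-elim (no-singleton-family G (proj₁ ν≡1)))
                       , (λ ν≡0 → ⊥-elim (no-empty-family G (proj₁ ν≡0)))
lemma8 (suc (suc n)) G = (λ ν≡n → s≤s (s≤s z≤n) , majority-game G ν≡n) , ν≡n∸1
  where
  ν≡n∸1 : NuEq G (suc n) → ν≡n∸1-Game (suc (suc n)) G
  ν≡n∸1 (family , atLeast) with a , b , a≢b , ab ← family⇒edge G family
    with edgeShape G (family⇒allBut-wins G family) atLeast a≢b ab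
  ... | star-shaped a≢b′ ab′ star       = star-game (pairDetermined G family atLeast) a≢b′ ab′ star
  ... | triangle-shaped distinct clique = triangle-game (pairDetermined G family atLeast) distinct clique
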